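{- Let $\lambda$ be a Young diagram, let $m_1,m_2$ be minimal with $\lambda\subseteq[m_1]\times[m_2]$, let $\underline d\in\mathbb N^{m_1+m_2-1}$ and $k\in\mathbb N$. Let $C\subsetneq\lambda$ be an up-set and let $r=(a,b)$ be a maximal element of $\lambda\setminus C$. Let $i_{\max}(r)=\min\{a,b\}-1$ and, for $0\le i\le i_{\max}(r)$, let $\varphi_i=\varphi_{w_i,F_i}$ be the tropical map with $w_i=e_{(a-i-1,b-i-1)}-e_{(a-i,b-i)}$ and $F_i=\mathrm{conv}\{e_{(a-i-1,b-i)},e_{(a-i,b-i-1)}\}$. Then for every $i\in\{0,\dots,i_{\max}(r)\}$, the set $\varphi_i\big((\varphi_{i-1}\circ\dots\circ\varphi_0)(\mathcal O_C(\lambda)^k_{\underline d})\big)$ is convex; that is, $\varphi_i$ gives a combinatorial mutation of the polytope $(\varphi_{i-1}\circ\dots\circ\varphi_0)(\mathcal O_C(\lambda)^k_{\underline d})$ (for $i=0$ this polytope is $\mathcal O_C(\lambda)^k_{\underline d}$).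
   Context: $\mathbb N=\{1,2,\dots\}$, $[n]=\{1,\dots,n\}$; $\mathbb N^2$ has the componentwise order. A Young diagram is a finite nonempty down-set $\lambda\subseteq\mathbb N^2$. $\mathbb R^\lambda$ has basis $\{e_p\}_{p\in\lambda}$; for $p\in\mathbb Z^2\setminus\lambda$ set $x_p=0$, $e_p=0$. Diagonals are indexed by $\ell\in\{1-m_2,\dots,m_1-1\}$, the $\ell$th being $\{(i,j)\in\lambda\mid i-j=\ell\}$ with maximal element $r_\ell$; $\underline d=(d_\ell)_\ell$. Tropical map: for primitive $w$ and lattice polytope $F\subset w^\perp$, $\varphi_{w,F}(x)=x-(\min_{f\in F}x\cdot f)w$; if $\varphi_{w,F}(P)$ is convex it is called a combinatorial mutation of $P$. Chain-order polytope for an up-set $C\subsetneq\lambda$: $\mathcal O_C(\lambda)$ is the set of $x\in\mathbb R^\lambda$ with $0\le x_p\le1$ for all $p$; $x_p\le x_q$ for all $p\le q$ in $\lambda\setminus C$; and $x_p+x_{q_1}+\dots+x_{q_n}\le1$ for all $p\in\lambda\setminus C$, $q_1,\dots,q_n\in C$ with $p<q_1<\dots<q_n$. Restricted chain-order polytope: for each $\ell$, $R_\ell=\{p\in\lambda\mid p\le r_\ell\}$; $S_\ell$ = maximal elements of $(\lambda\setminus C)\cap R_\ell$; $\overline{S_\ell}=\{(a',b')\in R_\ell\mid (a'+i,b'+i)\in S_\ell \text{ for some } i\ge0\}$; $T_\ell$ = minimal elements of $C\cap R_\ell$; $\overline{T_\ell}=\{(a',b')\in R_\ell\mid (a'+i,b'+i)\in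 T_\ell \text{ for some } i\ge1\}$. Then $\mathcal O_C(\lambda)^k_{\underline d}=\{x\in k\mathcal O_C(\lambda)\mid \sum_{s\in\overline{S_\ell}}x_s-\sum_{t\in\overline{T_\ell}}x_t+\sum_{u\in C\cap R_\ell}x_u=d_\ell \text{ for each } \ell\}$.
   Formalization: Points are taken in ℚ^λ rather than ℝ^λ and the weights in convex combinations are rational, so the polytope $\mathcal O_C(\lambda)^k_{\underline d}$ and its images under the tropical maps lie in ℚ^λ. -}

module Defs where

open import Data.Bool using (Bool; true; false; _∧_; not; if_then_else_)
open import Data.Nat as ℕ using (ℕ; zero; suc; _∸_; _≤ᵇ_; _≡ᵇ_)
open import Data.Integer as ℤ using (ℤ; +_)
open import Data.Rational as ℚ using (ℚ; 0ℚ; 1ℚ; _/_)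
open import Data.List using (List; []; _∷_; map; foldr; filterᵇ; concatMap; upTo)
open import Data.Bool.ListAction using (any)
open import Data.List.NonEmpty using (List⁺; _∷_; foldr₁) renaming (map to map⁺)
open import Data.Product using (_×_; _,_; proj₁; proj₂; Σ; ∃)
open import Data.Unit using (⊤)
open import Relation.Binary.PropositionalEquality using (_≡_; _≢_)
open import Relation.Nullary using (does)

-- Cells of ℕ² (1-based), componentwise order

Cell : Set
Cell = ℕ × ℕ

_≤c_ : Cell → Cell → Set
(i , j) ≤c (i' , j') = (i ℕ.≤ i') × (j ℕ.≤ j')

_<c_ : Cell → Cell → Set
p <c q = (p ≤c q) × (p ≢ q)

_≤ᵇc_ : Cell → Cell → Bool
(i , j) ≤ᵇc (i' , j') = (i ≤ᵇ i') ∧ (j ≤ᵇ j')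

_≡ᵇc_ : Cell → Cell → Bool
(i , j) ≡ᵇc (i' , j') = (i ≡ᵇ i') ∧ (j ≡ᵇ j')

_<ᵇc_ : Cell → Cell → Bool
p <ᵇc q = (p ≤ᵇc q) ∧ not (p ≡ᵇc q)

-- Young diagrams: finite nonempty down-sets λ ⊆ ℕ² (ℕ = {1,2,...}),
-- given by a decidable membership predicate; m₁, m₂ are minimal with
-- λ ⊆ [m₁] × [m₂] (so (m₁,1) and (1,m₂) lie in λ, by down-closure).

record YoungDiagram : Set where
  field
    m₁ m₂      : ℕ
    mem        : Cell → Bool
    bounded    : ∀ i j → mem (i , j) ≡ true →
                 (1 ℕ.≤ i) × (i ℕ.≤ m₁) × (1 ℕ.≤ j) × (j ℕ.≤ m₂)
    downClosed : ∀ p q → 1 ℕ.≤ proj₁ p → 1 ℕ.≤ proj₂ p → p ≤c q →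
                 mem q ≡ true → mem p ≡ true
    corner₁    : mem (m₁ , 1) ≡ true
    corner₂    : mem (1 , m₂) ≡ true

-- Points of ℚ^λ: functions on cells; only coordinates in λ matter
-- (coordinates outside λ are read as 0 via `coord`).
Pt : Set
Pt = Cell → ℚ

ℚofℕ : ℕ → ℚ
ℚofℕ n = (+ n) / 1

module _ (Y : YoungDiagram) where
  open YoungDiagram Y

  _∈λ : Cell → Set
  p ∈λ = mem p ≡ true

  grid : List Cell
  grid = concatMap (λ i → map (λ j → (suc i , suc j)) (upTo m₂)) (upTo m₁)

  cells : List Cell
  cells = filterᵇ mem grid

  sumOver : (Cell → Bool) → (Cell → ℚ) → ℚ
  sumOver P f = foldr (λ p acc → (if P p then f p else 0ℚ) ℚ.+ acc) 0ℚ cells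

  coord : Pt → Cell → ℚ
  coord x p = if mem p then x p else 0ℚ

  e : Cell → Pt
  e p q = if mem p ∧ (p ≡ᵇc q) then 1ℚ else 0ℚ

  dot : Pt → Pt → ℚ
  dot x f = sumOver (λ _ → true) (λ p → x p ℚ.* f p)

  -- tropical map φ_{w,F}(x) = x - (min_{f∈F} x·f) w, where F = conv(V)
  -- is given by its (nonempty) list of vertices V; the minimum of the
  -- linear functional x·(-) over conv(V) is attained at a vertex.
  tropicalMap : Pt → List⁺ Pt → Pt → Pt
  tropicalMap w V x p = x p ℚ.- (foldr₁ ℚ._⊓_ (map⁺ (dot x) V) ℚ.* w p)

  Convex : (Pt → Set) → Set
  Convex S = ∀ y z (t : ℚ) → S y → S z → 0ℚ ℚ.≤ t → t ℚ.≤ 1ℚ →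
             S (λ p → (t ℚ.* y p) ℚ.+ ((1ℚ ℚ.- t) ℚ.* z p))

  module _ (C : Cell → Bool) where

    IsUpSet : Set
    IsUpSet = (∀ p → C p ≡ true → mem p ≡ true) ×
              (∀ p q → C p ≡ true → p ≤c q → mem q ≡ true → C q ≡ true)

    ProperSub : Set
    ProperSub = ∃ λ p → (mem p ≡ true) × (C p ≡ false)

    outC : Cell → Bool
    outC p = mem p ∧ not (C p)

    MaximalOutside : Cell → Set
    MaximalOutside r = (outC r ≡ true) × (∀ q → outC q ≡ true → r ≤c q → q ≡ r)

    ChainInC : Cell → List Cell → Set
    ChainInC p [] = ⊤
    ChainInC p (q ∷ qs) = (p <c q) × (C q ≡ true) × ChainInC q qs

    sumList : Pt → List Cell → ℚ
    sumList x qs = foldr (λ q acc → x q ℚ.+ acc) 0ℚ qs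

    ChainOrder : Pt → Set
    ChainOrder x =
      (∀ p → mem p ≡ true → (0ℚ ℚ.≤ x p) × (x p ℚ.≤ 1ℚ)) ×
      (∀ p q → outC p ≡ true → outC q ≡ true → p ≤c q → x p ℚ.≤ x q) ×
      (∀ p qs → outC p ≡ true → ChainInC p qs → (x p ℚ.+ sumList x qs) ℚ.≤ 1ℚ)

    DilatedChainOrder : ℕ → Pt → Set
    DilatedChainOrder k x =
      ∃ λ y → ChainOrder y × (∀ p → mem p ≡ true → x p ≡ ℚofℕ k ℚ.* y p)

    diag : Cell → ℤ
    diag (i , j) = (+ i) ℤ.- (+ j)

    onDiag : ℤ → Cell → Bool
    onDiag ℓ p = does (diag p ℤ.≟ ℓ)

    DiagRange : ℤ → Set
    DiagRange ℓ = (ℤ.- (+ m₂) ℤ.< ℓ) × (ℓ ℤ.< + m₁)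

    -- maximal element r_ℓ of the ℓ-th diagonal (a chain), found by scanning
    -- the cells of λ on it for the largest first coordinate
    data MaybeCell : Set where
      none : MaybeCell
      some : Cell → MaybeCell

    rDiag : ℤ → MaybeCell
    rDiag ℓ = foldr step none cells
      where
      step : Cell → MaybeCell → MaybeCell
      step p acc with onDiag ℓ p
      ... | false = acc
      ... | true with acc
      ...   | none = some p
      ...   | some q = if proj₁ q ≤ᵇ proj₁ p then some p else some q

    R : ℤ → Cell → Bool
    R ℓ p with rDiag ℓ
    ... | none = false
    ... | some r = mem p ∧ (p ≤ᵇc r)

    anyCell : (Cell → Bool) → Bool
    anyCell P = any P cells

    S : ℤ → Cell → Bool
    S ℓ p = outC p ∧ R ℓ p ∧ not (anyCell (λ q → outC q ∧ R ℓ q ∧ (p <ᵇc q)))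

    -- S̄_ℓ = { (a',b') ∈ R_ℓ | (a'+i,b'+i) ∈ S_ℓ for some i ≥ 0 }
    -- (i ranges over 0..m₁, larger shifts leave λ)
    Sbar : ℤ → Cell → Bool
    Sbar ℓ (a' , b') = R ℓ (a' , b') ∧
      any (λ i → S ℓ (a' ℕ.+ i , b' ℕ.+ i)) (upTo (suc m₁))

    T : ℤ → Cell → Bool
    T ℓ p = C p ∧ R ℓ p ∧ not (anyCell (λ q → C q ∧ R ℓ q ∧ (q <ᵇc p)))

    Tbar : ℤ → Cell → Bool
    Tbar ℓ (a' , b') = R ℓ (a' , b') ∧
      any (λ i → T ℓ (a' ℕ.+ suc i , b' ℕ.+ suc i)) (upTo m₁)

    CR : ℤ → Cell → Bool
    CR ℓ p = C p ∧ R ℓ p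

    Restricted : ℕ → (ℤ → ℕ) → Pt → Set
    Restricted k d x = DilatedChainOrder k x ×
      (∀ ℓ → DiagRange ℓ →
        ((sumOver (Sbar ℓ) x ℚ.- sumOver (Tbar ℓ) x) ℚ.+ sumOver (CR ℓ) x)
          ≡ ℚofℕ (d ℓ))

  φ : ℕ → ℕ → ℕ → Pt → Pt
  φ a b i = tropicalMap w V
    where
    w : Pt
    w p = e (a ∸ i ∸ 1 , b ∸ i ∸ 1) p ℚ.- e (a ∸ i , b ∸ i) p
    V : List⁺ Pt
    V = e (a ∸ i ∸ 1 , b ∸ i) ∷ (e (a ∸ i , b ∸ i ∸ 1) ∷ [])

  Φ : ℕ → ℕ → ℕ → Pt → Pt
  Φ a b zero = φ a b zero
  Φ a b (suc i) x = φ a b (suc i) (Φ a b i x)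

  imax : ℕ → ℕ → ℕ
  imax a b = (a ℕ.⊓ b) ∸ 1

  MutatedImage : (C : Cell → Bool) → ℕ → (ℤ → ℕ) → ℕ → ℕ → ℕ → Pt → Set
  MutatedImage C k d a b i y =
    ∃ λ x → Restricted C k d x × (∀ p → mem p ≡ true → Φ a b i x p ≡ y p)

module Submission where

-- Write cell m = (a ∸ m , b ∸ m) for the cells on the diagonal through r = (a , b), and above m, left m for
-- the two cells that cell m covers.  The direction w m = e (cell (m + 1)) − e (cell m) of φ_m vanishes on
-- every above n and left n, so the quantity minNeighbour m x = x (above m) ⊓ x (left m) that φ_m subtracts
-- is not changed by φ_0, …, φ_(m-1), and Φ_i x = x − Σ_{m ≤ i} minNeighbour m x · w m.
--
-- Given preimages x, x′ and 0 ≤ t ≤ 1, put X = t x + (1 − t) x′.  By concavity of ⊓ the defects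
-- δ m = minNeighbour m X − (t minNeighbour m x + (1 − t) minNeighbour m x′) are nonnegative, and
-- lift = X + Σ_{m ≤ i} δ m · w m satisfies Φ_i lift = t Φ_i x + (1 − t) Φ_i x′.  The lift only moves the
-- mass δ m from cell m to cell (m + 1).  Afterwards cell m still dominates X on above m and left m, and
-- cell (m + 1) is still dominated by minNeighbour m X; as r is maximal in λ ∖ C, no cell m lies in C, and
-- these two bounds give all inequalities of the dilated chain-order polytope.  The diagonal equations
-- survive because cell m and cell (m + 1) always lie in the same sets S̄_ℓ, T̄_ℓ and C ∩ R_ℓ.

open import Defs
open import Data.Bool using (Bool)
open import Data.Nat using (ℕ; _<_)
open import Data.Product using (_,_)

module ListSums where

  open import Data.List using (List; []; _∷_; foldr; filterᵇ)
  open import Data.List.Membership.Propositional using (_∈_)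
  open import Data.List.Relation.Unary.Any using (here; there)
  open import Data.List.Relation.Unary.Unique.Propositional using (Unique; []; _∷_)
  open import Data.List.Relation.Unary.All as All using (All)
  open import Data.Bool using (true; false; if_then_else_)
  open import Data.Rational using (ℚ; 0ℚ; _+_; _*_; _-_; -_)
  import Data.Rational.Properties as ℚP
  open import Algebra.Bundles using (CommutativeMonoid)
  open import Algebra.Properties.CommutativeSemigroup (CommutativeMonoid.commutativeSemigroup ℚP.+-0-commutativeMonoid) using (interchange)
  open import Relation.Binary.PropositionalEquality
  open import Function using (_∘_)

  private variable
    A B : Set

  -- sumOver and sumList of the definitions unfold to instances of sumWith.
  sumWith : (A → ℚ) → List A → ℚ
  sumWith f = foldr (λ x acc → f x + acc) 0ℚ

  sumWith-cong : ∀ {f g : A → ℚ} {xs} → (∀ {x} → x ∈ xs → f x ≡ g x) → sumWith f xs ≡ sumWith g xs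
  sumWith-cong {xs = []}     f≡g = refl
  sumWith-cong {xs = x ∷ xs} f≡g = cong₂ _+_ (f≡g (here refl)) (sumWith-cong (f≡g ∘ there))

  sumWith-+ : ∀ (f g : A → ℚ) xs → sumWith (λ x → f x + g x) xs ≡ sumWith f xs + sumWith g xs
  sumWith-+ f g []       = sym (ℚP.+-identityˡ 0ℚ)
  sumWith-+ f g (x ∷ xs) = trans (cong (f x + g x +_) (sumWith-+ f g xs)) (interchange (f x) (g x) _ _)

  sumWith-zero : ∀ {f : A → ℚ} {xs} → (∀ {x} → x ∈ xs → f x ≡ 0ℚ) → sumWith f xs ≡ 0ℚ
  sumWith-zero {xs = []}     f≡0 = refl
  sumWith-zero {xs = x ∷ xs} f≡0 =
    trans (cong₂ _+_ (f≡0 (here refl)) (sumWith-zero (λ x∈ → f≡0 (there x∈)))) (ℚP.+-identityˡ 0ℚ)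

  sumWith-*ˡ : ∀ c (f : A → ℚ) xs → sumWith (λ x → c * f x) xs ≡ c * sumWith f xs
  sumWith-*ˡ c f []       = sym (ℚP.*-zeroʳ c)
  sumWith-*ˡ c f (x ∷ xs) = trans (cong (c * f x +_) (sumWith-*ˡ c f xs)) (sym (ℚP.*-distribˡ-+ c (f x) _))

  sumWith-neg : ∀ (f : A → ℚ) xs → sumWith (λ x → - f x) xs ≡ - sumWith f xs
  sumWith-neg f []       = refl
  sumWith-neg f (x ∷ xs) = trans (cong (- f x +_) (sumWith-neg f xs)) (sym (ℚP.neg-distrib-+ (f x) _))

  sumWith-sub : ∀ (f g : A → ℚ) xs → sumWith (λ x → f x - g x) xs ≡ sumWith f xs - sumWith g xs
  sumWith-sub f g xs = trans (sumWith-+ f (λ x → - g x) xs) (cong (sumWith f xs +_) (sumWith-neg g xs))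

  sumWith-comm : ∀ (h : A → B → ℚ) xs ys →
                 sumWith (λ x → sumWith (h x) ys) xs ≡ sumWith (λ y → sumWith (λ x → h x y) xs) ys
  sumWith-comm h []       ys = sym (sumWith-zero {xs = ys} (λ _ → refl))
  sumWith-comm h (x ∷ xs) ys = trans (cong (sumWith (h x) ys +_) (sumWith-comm h xs ys)) (sym (sumWith-+ (h x) _ ys))

  sumWith-filterᵇ : ∀ P (f : A → ℚ) xs →
                    sumWith f (filterᵇ P xs) ≡ sumWith (λ x → if P x then f x else 0ℚ) xs
  sumWith-filterᵇ P f []       = refl
  sumWith-filterᵇ P f (x ∷ xs) with P x
  ... | true  = cong (f x +_) (sumWith-filterᵇ P f xs)
  ... | false = trans (sumWith-filterᵇ P f xs) (sym (ℚP.+-identityˡ _))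

  sumWith-single : ∀ {f : A → ℚ} {u xs} → Unique xs → u ∈ xs → (∀ {x} → x ∈ xs → x ≢ u → f x ≡ 0ℚ) →
                   sumWith f xs ≡ f u
  sumWith-single {f = f} {u} (x∉xs ∷ xs!) (here refl) f≡0 =
    trans (cong (f u +_) (sumWith-zero (λ x∈ → f≡0 (there x∈) (All.lookup x∉xs x∈ ∘ sym)))) (ℚP.+-identityʳ (f u))
  sumWith-single {f = f} {u} (x∉xs ∷ xs!) (there u∈) f≡0 =
    trans (cong₂ _+_ (f≡0 (here refl) (λ { refl → All.lookup x∉xs u∈ refl })) (sumWith-single xs! u∈ (f≡0 ∘ there)))
          (ℚP.+-identityˡ (f u))

module RationalArithmetic where

  open import Data.Rational as ℚ using (ℚ; 0ℚ; 1ℚ; _≤_; _+_; _*_; _-_; -_; _⊓_)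
  import Data.Rational.Properties as ℚP
  open import Data.Rational.Solver using (module +-*-Solver)
  open +-*-Solver
  open import Data.Sum using (inj₁; inj₂)
  open import Relation.Binary.PropositionalEquality
  open import Defs using (ℚofℕ)

  +-preserves-0≤ : ∀ {p q} → 0ℚ ≤ p → 0ℚ ≤ q → 0ℚ ≤ p + q
  +-preserves-0≤ {p} {q} 0≤p 0≤q = subst (_≤ p + q) (ℚP.+-identityʳ 0ℚ) (ℚP.+-mono-≤ 0≤p 0≤q)

  *-monoˡ-≤-0≤ : ∀ {c p q} → 0ℚ ≤ c → p ≤ q → c * p ≤ c * q
  *-monoˡ-≤-0≤ {c} 0≤c = ℚP.*-monoˡ-≤-nonNeg c {{ℚ.nonNegative 0≤c}}

  *-preserves-0≤ : ∀ {p q} → 0ℚ ≤ p → 0ℚ ≤ q → 0ℚ ≤ p * q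
  *-preserves-0≤ {p} {q} 0≤p 0≤q = subst (_≤ p * q) (ℚP.*-zeroʳ p) (*-monoˡ-≤-0≤ 0≤p 0≤q)

  0≤ℚofℕ : ∀ k → 0ℚ ≤ ℚofℕ k
  0≤ℚofℕ k = ℚP.nonNegative⁻¹ (ℚofℕ k) {{ℚP.normalize-nonNeg k 1}}

  p≤q⇒0≤q-p : ∀ {p q} → p ≤ q → 0ℚ ≤ q - p
  p≤q⇒0≤q-p {p} {q} p≤q = subst (_≤ q - p) (ℚP.+-inverseʳ p) (ℚP.+-monoˡ-≤ (- p) p≤q)

  p≤p+q : ∀ p {q} → 0ℚ ≤ q → p ≤ p + q
  p≤p+q p {q} 0≤q = subst (_≤ p + q) (ℚP.+-identityʳ p) (ℚP.+-monoʳ-≤ p 0≤q)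

  p-r≤p+[q-r] : ∀ p r {q} → 0ℚ ≤ q → p - r ≤ p + (q - r)
  p-r≤p+[q-r] p r {q} 0≤q = ℚP.+-monoʳ-≤ p (subst (_≤ q - r) (ℚP.+-identityˡ (- r)) (ℚP.+-monoˡ-≤ (- r) 0≤q))

  p+[q-r]≤p+q : ∀ p q {r} → 0ℚ ≤ r → p + (q - r) ≤ p + q
  p+[q-r]≤p+q p q {r} 0≤r =
    ℚP.+-monoʳ-≤ p (subst (q - r ≤_) (ℚP.+-identityʳ q) (ℚP.+-monoʳ-≤ q (ℚP.neg-antimono-≤ 0≤r)))

  p+q≤r+s⇒p≤r-[q-s] : ∀ {p q r s} → p + q ≤ r + s → p ≤ r - (q - s)
  p+q≤r+s⇒p≤r-[q-s] {p} {q} {r} {s} p+q≤r+s = subst₂ _≤_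
    (solve 2 (λ p q → p :+ q :- q := p) refl p q)
    (solve 3 (λ r s q → r :+ s :- q := r :- (q :- s)) refl r s q)
    (ℚP.+-monoˡ-≤ (- q) p+q≤r+s)

  p+q≤r+p⊓q : ∀ {p q r} → p ≤ r → q ≤ r → p + q ≤ r + p ⊓ q
  p+q≤r+p⊓q {p} {q} {r} p≤r q≤r with ℚP.≤-total p q
  ... | inj₁ p≤q rewrite ℚP.p≤q⇒p⊓q≡p p≤q = subst (_≤ r + p) (ℚP.+-comm q p) (ℚP.+-monoˡ-≤ p q≤r)
  ... | inj₂ q≤p rewrite ℚP.p≥q⇒p⊓q≡q q≤p = ℚP.+-monoˡ-≤ q p≤r

  combination-mono-≤ : ∀ {t u p q p′ q′} → 0ℚ ≤ t → 0ℚ ≤ u → p ≤ q → p′ ≤ q′ →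
                       t * p + u * p′ ≤ t * q + u * q′
  combination-mono-≤ 0≤t 0≤u p≤q p′≤q′ = ℚP.+-mono-≤ (*-monoˡ-≤-0≤ 0≤t p≤q) (*-monoˡ-≤-0≤ 0≤u p′≤q′)

  ⊓-concave : ∀ {t u} p q p′ q′ → 0ℚ ≤ t → 0ℚ ≤ u →
              t * (p ⊓ q) + u * (p′ ⊓ q′) ≤ (t * p + u * p′) ⊓ (t * q + u * q′)
  ⊓-concave p q p′ q′ 0≤t 0≤u = ℚP.⊓-glb
    (combination-mono-≤ 0≤t 0≤u (ℚP.p⊓q≤p p q) (ℚP.p⊓q≤p p′ q′))
    (combination-mono-≤ 0≤t 0≤u (ℚP.p⊓q≤q p q) (ℚP.p⊓q≤q p′ q′))

  *-distribˡ-sub : ∀ p q r → p * (q - r) ≡ p * q - p * r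
  *-distribˡ-sub p q r = trans (ℚP.*-distribˡ-+ p q (- r)) (cong (p * q +_) (sym (ℚP.neg-distribʳ-* p r)))

  [p-q]-r≡p-[r+q] : ∀ p q r → (p - q) - r ≡ p - (r + q)
  [p-q]-r≡p-[r+q] = solve 3 (λ p q r → (p :- q) :- r := p :- (r :+ q)) refl

  p+[q-p]≡q : ∀ p q → p + (q - p) ≡ q
  p+[q-p]≡q = solve 2 (λ p q → p :+ (q :- p) := q) refl

  convex-combination-same : ∀ t p → t * p + (1ℚ - t) * p ≡ p
  convex-combination-same = solve 2 (λ t p → t :* p :+ (con 1ℚ :- t) :* p := p) refl

  combination-+ : ∀ t u p q p′ q′ → t * (p + q) + u * (p′ + q′) ≡ (t * p + u * p′) + (t * q + u * q′)
  combination-+ = solve 6 (λ t u p q p′ q′ → t :* (p :+ q) :+ u :* (p′ :+ q′) := (t :* p :+ u :* p′) :+ (t :* q :+ u :* q′)) refl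

  combination-linear : ∀ t p q r p′ q′ r′ →
    ((t * p + (1ℚ - t) * p′) - (t * q + (1ℚ - t) * q′)) + (t * r + (1ℚ - t) * r′) ≡
    t * ((p - q) + r) + (1ℚ - t) * ((p′ - q′) + r′)
  combination-linear = solve 7 (λ t p q r p′ q′ r′ →
    ((t :* p :+ (con 1ℚ :- t) :* p′) :- (t :* q :+ (con 1ℚ :- t) :* q′)) :+ (t :* r :+ (con 1ℚ :- t) :* r′) :=
    t :* ((p :- q) :+ r) :+ (con 1ℚ :- t) :* ((p′ :- q′) :+ r′)) refl

module CellsOfYoungDiagrams where

  open ListSums
  open import Data.Bool using (Bool; true; false; if_then_else_)
  import Data.Bool as Bool
  open import Data.Bool.Properties using (T-≡; ∧-conicalˡ; ∧-conicalʳ; not-injective)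
  open import Data.Nat using (suc; _≤_; _≡ᵇ_)
  import Data.Nat.Properties as ℕP
  open import Data.Rational using (0ℚ; 1ℚ; _+_; _*_)
  import Data.Rational.Properties as ℚP
  open import Data.List using ([]; _∷_; map; filterᵇ; concatMap; cartesianProductWith; upTo; _++_)
  open import Data.List.Membership.Propositional using (_∈_)
  open import Data.List.Membership.Propositional.Properties using (∈-filter⁺; ∈-cartesianProductWith⁺; ∈-upTo⁺)
  open import Data.List.Relation.Unary.Unique.Propositional using (Unique)
  open import Data.List.Relation.Unary.Unique.Propositional.Properties using (filter⁺; cartesianProductWith⁺; upTo⁺)
  open import Data.Product using (_×_; _,_; proj₁; proj₂)
  open import Data.Empty using (⊥-elim)
  open import Function using (_∘_)
  open import Function.Bundles using (Equivalence)
  open import Relation.Binary.PropositionalEquality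

  true-T : ∀ {b} → b ≡ true → Bool.T b
  true-T = Equivalence.from T-≡

  T-true : ∀ {b} → Bool.T b → b ≡ true
  T-true = Equivalence.to T-≡

  true≢false : true ≢ false
  true≢false ()

  true⇔true⇒≡ : ∀ {b c} → (b ≡ true → c ≡ true) → (c ≡ true → b ≡ true) → b ≡ c
  true⇔true⇒≡ {false} {false} _ _ = refl
  true⇔true⇒≡ {false} {true}  _ c⇒b = c⇒b refl
  true⇔true⇒≡ {true}  {false} b⇒c _ = sym (b⇒c refl)
  true⇔true⇒≡ {true}  {true}  _ _ = refl

  ≤ᵇc⇒≤c : ∀ p q → (p ≤ᵇc q) ≡ true → p ≤c q
  ≤ᵇc⇒≤c (p₁ , p₂) (q₁ , q₂) le =
    ℕP.≤ᵇ⇒≤ p₁ q₁ (true-T (∧-conicalˡ _ _ le)) , ℕP.≤ᵇ⇒≤ p₂ q₂ (true-T (∧-conicalʳ _ _ le))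

  ≤c⇒≤ᵇc : ∀ {p q} → p ≤c q → (p ≤ᵇc q) ≡ true
  ≤c⇒≤ᵇc (le₁ , le₂) rewrite T-true (ℕP.≤⇒≤ᵇ le₁) | T-true (ℕP.≤⇒≤ᵇ le₂) = refl

  ≡ᵇc-refl : ∀ p → (p ≡ᵇc p) ≡ true
  ≡ᵇc-refl (p₁ , p₂) rewrite T-true (ℕP.≡⇒≡ᵇ p₁ p₁ refl) | T-true (ℕP.≡⇒≡ᵇ p₂ p₂ refl) = refl

  ≢⇒≡ᵇc-false : ∀ {p q} → p ≢ q → (p ≡ᵇc q) ≡ false
  ≢⇒≡ᵇc-false {p₁ , p₂} {q₁ , q₂} p≢q with p₁ ≡ᵇ q₁ in eq₁ | p₂ ≡ᵇ q₂ in eq₂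
  ... | false | _     = refl
  ... | true  | false = refl
  ... | true  | true  = ⊥-elim (p≢q (cong₂ _,_ (ℕP.≡ᵇ⇒≡ p₁ q₁ (true-T eq₁)) (ℕP.≡ᵇ⇒≡ p₂ q₂ (true-T eq₂))))


  <c⇒<ᵇc : ∀ {p q} → p <c q → (p <ᵇc q) ≡ true
  <c⇒<ᵇc (p≤q , p≢q) rewrite ≤c⇒≤ᵇc p≤q | ≢⇒≡ᵇc-false p≢q = refl

  ≤c-trans : ∀ {p q r} → p ≤c q → q ≤c r → p ≤c r
  ≤c-trans (le₁ , le₂) (le₁′ , le₂′) = ℕP.≤-trans le₁ le₁′ , ℕP.≤-trans le₂ le₂′

  concatMap-map≡cartesianProductWith : ∀ {A B C : Set} (f : A → B → C) xs ys →
    concatMap (λ x → map (f x) ys) xs ≡ cartesianProductWith f xs ys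
  concatMap-map≡cartesianProductWith f []       ys = refl
  concatMap-map≡cartesianProductWith f (x ∷ xs) ys = cong (map (f x) ys ++_) (concatMap-map≡cartesianProductWith f xs ys)

  module _ (Y : YoungDiagram) where
    open YoungDiagram Y

    grid≡ : grid Y ≡ cartesianProductWith (λ i j → (suc i , suc j)) (upTo m₁) (upTo m₂)
    grid≡ = concatMap-map≡cartesianProductWith _ (upTo m₁) (upTo m₂)

    cells-unique : Unique (cells Y)
    cells-unique = filter⁺ (Bool.T? ∘ mem) (subst Unique (sym grid≡)
      (cartesianProductWith⁺ _ (λ { refl → refl , refl }) (upTo⁺ m₁) (upTo⁺ m₂)))

    ∈λ⇒1≤ : ∀ {u} → mem u ≡ true → 1 ≤ proj₁ u × 1 ≤ proj₂ u
    ∈λ⇒1≤ {u₁ , u₂} u∈λ with bounded u₁ u₂ u∈λ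
    ... | 1≤u₁ , _ , 1≤u₂ , _ = 1≤u₁ , 1≤u₂

    0,y∉λ : ∀ y → mem (0 , y) ≡ false
    0,y∉λ y with mem (0 , y) in 0,y∈λ
    ... | false = refl
    ... | true with ∈λ⇒1≤ 0,y∈λ
    ...   | () , _

    x,0∉λ : ∀ x → mem (x , 0) ≡ false
    x,0∉λ x with mem (x , 0) in x,0∈λ
    ... | false = refl
    ... | true with ∈λ⇒1≤ x,0∈λ
    ...   | _ , ()

    outC⇒∈λ : ∀ C {u} → outC Y C u ≡ true → mem u ≡ true
    outC⇒∈λ C {u} = ∧-conicalˡ (mem u) _

    outC-≢-C : ∀ C {u q} → outC Y C u ≡ true → C q ≡ true → u ≢ q
    outC-≢-C C {u} u∉C q∈C refl = true≢false (trans (sym q∈C) (not-injective (∧-conicalʳ (mem u) _ u∉C)))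

    ∈λ⇒∈cells : ∀ {p} → mem p ≡ true → p ∈ cells Y
    ∈λ⇒∈cells {p₁ , p₂} p∈λ with bounded p₁ p₂ p∈λ
    ∈λ⇒∈cells {suc i , suc j} p∈λ | _ , i<m₁ , _ , j<m₂ =
      ∈-filter⁺ (Bool.T? ∘ mem) (subst ((suc i , suc j) ∈_) (sym grid≡)
        (∈-cartesianProductWith⁺ _ (∈-upTo⁺ i<m₁) (∈-upTo⁺ j<m₂))) (true-T p∈λ)

    e-off : ∀ {u p} → p ≢ u → e Y u p ≡ 0ℚ
    e-off {u} p≢u rewrite ≢⇒≡ᵇc-false (p≢u ∘ sym) with mem u
    ... | true  = refl
    ... | false = refl

    e-outside : ∀ {u} p → mem u ≡ false → e Y u p ≡ 0ℚ
    e-outside p u∉λ rewrite u∉λ = refl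

    e-diag : ∀ {u} → mem u ≡ true → e Y u u ≡ 1ℚ
    e-diag {u} u∈λ rewrite u∈λ | ≡ᵇc-refl u = refl

    coord-cong : ∀ {x y} u → x u ≡ y u → coord Y x u ≡ coord Y y u
    coord-cong u = cong (if mem u then_else 0ℚ)

    coord-∈ : ∀ x {p} → mem p ≡ true → coord Y x p ≡ x p
    coord-∈ x p∈λ rewrite p∈λ = refl

    coord-∉ : ∀ x {p} → mem p ≡ false → coord Y x p ≡ 0ℚ
    coord-∉ x p∉λ rewrite p∉λ = refl

    dot-e : ∀ x u → dot Y x (e Y u) ≡ coord Y x u
    dot-e x u = by-membership (mem u) refl
      where
      open ≡-Reasoning
      by-membership : ∀ b → mem u ≡ b → dot Y x (e Y u) ≡ coord Y x u
      by-membership true u∈λ = begin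
        sumWith (λ p → x p * e Y u p) (cells Y) ≡⟨ sumWith-single cells-unique (∈λ⇒∈cells u∈λ) x*e≡0 ⟩
        x u * e Y u u                             ≡⟨ cong (x u *_) (e-diag u∈λ) ⟩
        x u * 1ℚ                                  ≡⟨ ℚP.*-identityʳ (x u) ⟩
        x u                                       ≡⟨ coord-∈ x u∈λ ⟨
        coord Y x u                               ∎
        where
        x*e≡0 : ∀ {p} → p ∈ cells Y → p ≢ u → x p * e Y u p ≡ 0ℚ
        x*e≡0 {p} _ p≢u = trans (cong (x p *_) (e-off p≢u)) (ℚP.*-zeroʳ (x p))
      by-membership false u∉λ =
        trans (sumWith-zero {xs = cells Y} (λ {p} _ → trans (cong (x p *_) (e-outside p u∉λ)) (ℚP.*-zeroʳ (x p))))
              (sym (coord-∉ x u∉λ))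

    sumOver-e : ∀ P {u} → mem u ≡ true → sumOver Y P (e Y u) ≡ (if P u then 1ℚ else 0ℚ)
    sumOver-e P {u} u∈λ =
      trans (sumWith-single cells-unique (∈λ⇒∈cells u∈λ) masked-e≡0) (cong (if P u then_else 0ℚ) (e-diag u∈λ))
      where
      masked-e≡0 : ∀ {p} → p ∈ cells Y → p ≢ u → (if P p then e Y u p else 0ℚ) ≡ 0ℚ
      masked-e≡0 {p} _ p≢u with P p
      ... | true  = e-off p≢u
      ... | false = refl

    sumOver≡sumWith-filterᵇ : ∀ P f → sumOver Y P f ≡ sumWith f (filterᵇ P (cells Y))
    sumOver≡sumWith-filterᵇ P f = sym (sumWith-filterᵇ P f (cells Y))

module ScaledChainOrders where

  open ListSums
  open RationalArithmetic
  open CellsOfYoungDiagrams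
  open import Data.Bool using (Bool; true; false)
  open import Data.Nat using (zero; suc)
  open import Data.Rational as ℚ using (ℚ; 0ℚ; 1ℚ; _≤_; _+_; _*_; _-_)
  import Data.Rational.Properties as ℚP
  open import Data.List using ([]; _∷_)
  open import Data.Product using (_×_; _,_; proj₁; proj₂)
  open import Relation.Binary.PropositionalEquality
  open import Algebra.Bundles using (CommutativeMonoid)
  open import Algebra.Properties.CommutativeSemigroup (CommutativeMonoid.commutativeSemigroup ℚP.+-0-commutativeMonoid) using (interchange)

  module _ (Y : YoungDiagram) (C : Cell → Bool) where
    open YoungDiagram Y

    -- The dilation K · O_C(λ); ChainOrder Y C unfolds to ScaledChainOrder 1ℚ.
    ScaledChainOrder : ℚ → Pt → Set
    ScaledChainOrder K x =
      (∀ p → mem p ≡ true → (0ℚ ≤ x p) × (x p ≤ K)) ×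
      (∀ p q → outC Y C p ≡ true → outC Y C q ≡ true → p ≤c q → x p ≤ x q) ×
      (∀ p qs → outC Y C p ≡ true → ChainInC Y C p qs → x p + sumList Y C x qs ≤ K)

    ScaledChainOrder-cong : (∀ p → C p ≡ true → mem p ≡ true) → ∀ {K x x′} →
      (∀ p → mem p ≡ true → x p ≡ x′ p) → ScaledChainOrder K x → ScaledChainOrder K x′
    ScaledChainOrder-cong C⊆λ {K} {x} {x′} x≡x′ (bounds , mono , chain) =
      (λ p p∈λ → subst (λ v → (0ℚ ≤ v) × (v ≤ K)) (x≡x′ p p∈λ) (bounds p p∈λ)) ,
      (λ p q p∉C q∉C p≤q →
        subst₂ _≤_ (x≡x′ p (outC⇒∈λ Y C p∉C)) (x≡x′ q (outC⇒∈λ Y C q∉C)) (mono p q p∉C q∉C p≤q)) ,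
      (λ p qs p∉C ch → subst (_≤ K) (cong₂ _+_ (x≡x′ p (outC⇒∈λ Y C p∉C)) (sumList-cong p qs ch)) (chain p qs p∉C ch))
      where
      sumList-cong : ∀ p qs → ChainInC Y C p qs → sumList Y C x qs ≡ sumList Y C x′ qs
      sumList-cong p []       _                = refl
      sumList-cong p (q ∷ qs) (_ , q∈C , ch) = cong₂ _+_ (x≡x′ q (C⊆λ q q∈C)) (sumList-cong q qs ch)

    ScaledChainOrder-* : ∀ {c K x} → 0ℚ ≤ c → ScaledChainOrder K x → ScaledChainOrder (c * K) (λ p → c * x p)
    ScaledChainOrder-* {c} {K} {x} 0≤c (bounds , mono , chain) =
      (λ p p∈λ → *-preserves-0≤ 0≤c (proj₁ (bounds p p∈λ)) , *-monoˡ-≤-0≤ 0≤c (proj₂ (bounds p p∈λ))) ,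
      (λ p q p∉C q∉C p≤q → *-monoˡ-≤-0≤ 0≤c (mono p q p∉C q∉C p≤q)) ,
      (λ p qs p∉C ch → subst (_≤ c * K)
        (trans (ℚP.*-distribˡ-+ c (x p) _) (cong (c * x p +_) (sym (sumWith-*ˡ c x qs))))
        (*-monoˡ-≤-0≤ 0≤c (chain p qs p∉C ch)))

    ScaledChainOrder-+ : ∀ {K K′ x x′} → ScaledChainOrder K x → ScaledChainOrder K′ x′ →
                         ScaledChainOrder (K + K′) (λ p → x p + x′ p)
    ScaledChainOrder-+ {K} {K′} {x} {x′} (bounds , mono , chain) (bounds′ , mono′ , chain′) =
      (λ p p∈λ → +-preserves-0≤ (proj₁ (bounds p p∈λ)) (proj₁ (bounds′ p p∈λ)) ,
                 ℚP.+-mono-≤ (proj₂ (bounds p p∈λ)) (proj₂ (bounds′ p p∈λ))) ,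
      (λ p q p∉C q∉C p≤q → ℚP.+-mono-≤ (mono p q p∉C q∉C p≤q) (mono′ p q p∉C q∉C p≤q)) ,
      (λ p qs p∉C ch → subst (_≤ K + K′)
        (trans (interchange (x p) _ (x′ p) _) (cong (x p + x′ p +_) (sym (sumWith-+ x x′ qs))))
        (ℚP.+-mono-≤ (chain p qs p∉C ch) (chain′ p qs p∉C ch)))

    ScaledChainOrder-convex : ∀ {K x x′ t} → 0ℚ ≤ t → t ≤ 1ℚ →
      ScaledChainOrder K x → ScaledChainOrder K x′ → ScaledChainOrder K (λ p → t * x p + (1ℚ - t) * x′ p)
    ScaledChainOrder-convex {K} {t = t} 0≤t t≤1 x∈ x′∈ = subst (λ K → ScaledChainOrder K _) (convex-combination-same t K)
      (ScaledChainOrder-+ (ScaledChainOrder-* 0≤t x∈) (ScaledChainOrder-* (p≤q⇒0≤q-p t≤1) x′∈))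

    ScaledChainOrder-mono : ∀ {K K′ x} → K ≤ K′ → ScaledChainOrder K x → ScaledChainOrder K′ x
    ScaledChainOrder-mono K≤K′ (bounds , mono , chain) =
      (λ p p∈λ → proj₁ (bounds p p∈λ) , ℚP.≤-trans (proj₂ (bounds p p∈λ)) K≤K′) ,
      mono ,
      (λ p qs p∉C ch → ℚP.≤-trans (chain p qs p∉C ch) K≤K′)

    coord-nonneg : ∀ {K x} → ScaledChainOrder K x → ∀ u → 0ℚ ≤ coord Y x u
    coord-nonneg x∈ u with mem u in u∈λ
    ... | true  = proj₁ (proj₁ x∈ u u∈λ)
    ... | false = ℚP.≤-refl

    module _ (C⊆λ : ∀ p → C p ≡ true → mem p ≡ true) where

      dilated⇒scaled : ∀ k {x} → DilatedChainOrder Y C k x → ScaledChainOrder (ℚofℕ k) x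
      dilated⇒scaled k (y , y∈O , x≡ky) = subst (λ K → ScaledChainOrder K _) (ℚP.*-identityʳ (ℚofℕ k))
        (ScaledChainOrder-cong C⊆λ (λ p p∈λ → sym (x≡ky p p∈λ)) (ScaledChainOrder-* (0≤ℚofℕ k) y∈O))

      scaled⇒dilated : ∀ k {x} → ScaledChainOrder (ℚofℕ k) x → DilatedChainOrder Y C k x
      scaled⇒dilated zero {x} x∈ =
        x , ScaledChainOrder-mono (ℚP.nonNegative⁻¹ 1ℚ) x∈ , x≡0*x
        where
        x≡0*x : ∀ p → mem p ≡ true → x p ≡ 0ℚ * x p
        x≡0*x p p∈λ =
          trans (ℚP.≤-antisym (proj₂ (proj₁ x∈ p p∈λ)) (proj₁ (proj₁ x∈ p p∈λ))) (sym (ℚP.*-zeroˡ (x p)))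
      scaled⇒dilated k@(suc _) {x} x∈ =
        (λ p → 1/K * x p) ,
        subst (λ K → ScaledChainOrder K (λ p → 1/K * x p)) (ℚP.*-inverseˡ K) (ScaledChainOrder-* 0≤1/K x∈) ,
        λ p _ → sym (trans (sym (ℚP.*-assoc K 1/K (x p))) (trans (cong (_* x p) (ℚP.*-inverseʳ K)) (ℚP.*-identityˡ (x p))))
        where
        K = ℚofℕ k
        instance
          K-positive : ℚ.Positive K
          K-positive = ℚP.normalize-pos k 1
          K-nonZero : ℚ.NonZero K
          K-nonZero = ℚP.pos⇒nonZero K
        1/K = ℚ.1/ K
        0≤1/K : 0ℚ ≤ 1/K
        0≤1/K = ℚP.nonNegative⁻¹ 1/K {{ℚP.pos⇒nonNeg 1/K {{ℚP.1/pos⇒pos K}}}}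

module DiagonalConstraints where

  open CellsOfYoungDiagrams
  open import Data.Bool using (Bool; true; false; _∧_)
  open import Data.Bool.Properties using (∧-conicalˡ; ∧-conicalʳ; not-injective)
  open import Data.Bool.ListAction using (any)
  open import Data.Nat as ℕ using (ℕ; zero; suc; _+_; _≤ᵇ_; z≤n; s≤s)
  import Data.Nat.Properties as ℕP
  open import Data.Integer as ℤ using (ℤ; +_)
  open import Data.Rational as ℚ using (ℚ)
  import Data.Integer.Properties as ℤP
  open import Data.List using (List; []; _∷_; foldr; upTo)
  open import Data.List.Membership.Propositional using (_∈_; find; lose)
  open import Data.List.Membership.Propositional.Properties using (∈-upTo⁺; ∈-upTo⁻)
  open import Data.List.Relation.Unary.Any using (here; there)
  open import Data.List.Relation.Unary.Any.Properties using (any⁺; any⁻)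
  open import Data.Product using (_×_; _,_; proj₁; proj₂; Σ; ∃)
  open import Data.Empty using (⊥-elim)
  open import Relation.Binary.PropositionalEquality
  open import Relation.Nullary using (¬_; does)
  open import Function using (_∘_)

  any-upTo⁺ : ∀ (P : ℕ → Bool) {n i} → i ℕ.< n → P i ≡ true → any P (upTo n) ≡ true
  any-upTo⁺ P i<n Pi = T-true (any⁺ P (lose (∈-upTo⁺ i<n) (true-T Pi)))

  any-upTo⁻ : ∀ (P : ℕ → Bool) n → any P (upTo n) ≡ true → ∃ λ i → i ℕ.< n × P i ≡ true
  any-upTo⁻ P n any≡true with find (any⁻ P (upTo n) (true-T any≡true))
  ... | i , i∈ , Pi = i , ∈-upTo⁻ i∈ , T-true Pi

  module _ (Y : YoungDiagram) (C : Cell → Bool) where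
    open YoungDiagram Y

    diagonalSum : ℤ → Pt → ℚ
    diagonalSum ℓ x = (sumOver Y (Sbar Y C ℓ) x ℚ.- sumOver Y (Tbar Y C ℓ) x) ℚ.+ sumOver Y (CR Y C ℓ) x

    data DiagonalMaximum (ℓ : ℤ) (L : List Cell) : MaybeCell Y C → Set where
      none : (∀ {u} → u ∈ L → onDiag Y C ℓ u ≢ true) → DiagonalMaximum ℓ L none
      some : ∀ {ρ} → onDiag Y C ℓ ρ ≡ true → (∀ {u} → u ∈ L → onDiag Y C ℓ u ≡ true → proj₁ u ℕ.≤ proj₁ ρ) →
             DiagonalMaximum ℓ L (some ρ)

    private
      -- The scan defining rDiag uses a step function local to that definition; this recovers it.
      rDiag-as-foldr : ∀ ℓ → Σ (Cell → MaybeCell Y C → MaybeCell Y C) λ step → rDiag Y C ℓ ≡ foldr step none (cells Y)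
      rDiag-as-foldr ℓ = _ , refl

      step : ℤ → Cell → MaybeCell Y C → MaybeCell Y C
      step ℓ = proj₁ (rDiag-as-foldr ℓ)

      skip : ∀ {ℓ p L m} → onDiag Y C ℓ p ≡ false → DiagonalMaximum ℓ L m → DiagonalMaximum ℓ (p ∷ L) m
      skip p∉ℓ (none off) = none λ { (here refl) p∈ℓ → true≢false (trans (sym p∈ℓ) p∉ℓ) ; (there u∈) → off u∈ }
      skip p∉ℓ (some ρ∈ℓ below) =
        some ρ∈ℓ λ { (here refl) p∈ℓ → ⊥-elim (true≢false (trans (sym p∈ℓ) p∉ℓ)) ; (there u∈) → below u∈ }

      step-preserves : ∀ ℓ p {L m} → DiagonalMaximum ℓ L m → DiagonalMaximum ℓ (p ∷ L) (step ℓ p m)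
      step-preserves ℓ p dm with onDiag Y C ℓ p in p∈ℓ
      ... | false = skip p∈ℓ dm
      ... | true with dm
      ...   | none off = some p∈ℓ λ { (here refl) _ → ℕP.≤-refl ; (there u∈) u∈ℓ → ⊥-elim (off u∈ u∈ℓ) }
      ...   | some {ρ} ρ∈ℓ below with proj₁ ρ ≤ᵇ proj₁ p in ρ≤p
      ...     | true  = some p∈ℓ λ { (here refl) _ → ℕP.≤-refl
                                    ; (there u∈) u∈ℓ → ℕP.≤-trans (below u∈ u∈ℓ) (ℕP.≤ᵇ⇒≤ _ _ (true-T ρ≤p)) }
      ...     | false = some ρ∈ℓ λ { (here refl) _ → ℕP.<⇒≤ (ℕP.≰⇒> (p≰ρ ρ≤p))
                                    ; (there u∈) u∈ℓ → below u∈ u∈ℓ }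
        where
        p≰ρ : ∀ {ρ₁} → (ρ₁ ≤ᵇ proj₁ p) ≡ false → ¬ ρ₁ ℕ.≤ proj₁ p
        p≰ρ ρ≰ᵇp ρ≤p = true≢false (trans (sym (T-true (ℕP.≤⇒≤ᵇ ρ≤p))) ρ≰ᵇp)

      foldr-step : ∀ ℓ L → DiagonalMaximum ℓ L (foldr (step ℓ) none L)
      foldr-step ℓ []      = none λ ()
      foldr-step ℓ (p ∷ L) = step-preserves ℓ p (foldr-step ℓ L)

    rDiag-maximum : ∀ {ℓ ρ} → rDiag Y C ℓ ≡ some ρ →
      onDiag Y C ℓ ρ ≡ true × (∀ {u} → mem u ≡ true → onDiag Y C ℓ u ≡ true → proj₁ u ℕ.≤ proj₁ ρ)
    rDiag-maximum {ℓ} eq with rDiag Y C ℓ | foldr-step ℓ (cells Y)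
    rDiag-maximum refl | .(some _) | some ρ∈ℓ below = ρ∈ℓ , λ u∈λ → below (∈λ⇒∈cells Y u∈λ)

    ∈λ⇒≤m₁ : ∀ {x y} → mem (x , y) ≡ true → x ℕ.≤ m₁
    ∈λ⇒≤m₁ {x} {y} p∈λ = proj₁ (proj₂ (bounded x y p∈λ))

    S⇒∈λ : ∀ {ℓ p} → S Y C ℓ p ≡ true → mem p ≡ true
    S⇒∈λ {ℓ} {p} Sp = outC⇒∈λ Y C (∧-conicalˡ (outC Y C p) _ Sp)

    R-some : ∀ {ℓ ρ} p → rDiag Y C ℓ ≡ some ρ → R Y C ℓ p ≡ (mem p ∧ (p ≤ᵇc ρ))
    R-some {ℓ} p eq with rDiag Y C ℓ
    R-some p refl | .(some _) = refl

    R-none : ∀ {ℓ} p → rDiag Y C ℓ ≡ none → R Y C ℓ p ≡ false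
    R-none {ℓ} p eq with rDiag Y C ℓ
    R-none p refl | .none = refl

    R-intro : ∀ {ℓ ρ p} → rDiag Y C ℓ ≡ some ρ → mem p ≡ true → p ≤c ρ → R Y C ℓ p ≡ true
    R-intro {p = p} eq p∈λ p≤ρ rewrite R-some p eq | p∈λ | ≤c⇒≤ᵇc p≤ρ = refl

    R-elim : ∀ {ℓ p} → R Y C ℓ p ≡ true → ∃ λ ρ → rDiag Y C ℓ ≡ some ρ × mem p ≡ true × p ≤c ρ
    R-elim {ℓ} {p} Rp = by-rDiag (rDiag Y C ℓ) refl
      where
      by-rDiag : ∀ m → rDiag Y C ℓ ≡ m → ∃ λ ρ → rDiag Y C ℓ ≡ some ρ × mem p ≡ true × p ≤c ρ
      by-rDiag none     eq = ⊥-elim (true≢false (trans (sym Rp) (R-none p eq)))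
      by-rDiag (some ρ) eq = ρ , eq , ∧-conicalˡ (mem p) _ p∈R , ≤ᵇc⇒≤c p ρ (∧-conicalʳ (mem p) _ p∈R)
        where p∈R = trans (sym (R-some p eq)) Rp

    R-downClosed : ∀ {ℓ p q} → R Y C ℓ q ≡ true → 1 ℕ.≤ proj₁ p → 1 ℕ.≤ proj₂ p → p ≤c q → R Y C ℓ p ≡ true
    R-downClosed {p = p} {q} Rq 1≤p₁ 1≤p₂ p≤q with R-elim Rq
    ... | ρ , eq , q∈λ , q≤ρ = R-intro eq (downClosed p q 1≤p₁ 1≤p₂ p≤q q∈λ) (≤c-trans p≤q q≤ρ)

    S⇒R : ∀ {ℓ p} → S Y C ℓ p ≡ true → R Y C ℓ p ≡ true
    S⇒R {ℓ} {p} Sp = ∧-conicalˡ (R Y C ℓ p) _ (∧-conicalʳ (outC Y C p) _ Sp)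

    S-maximal : ∀ {ℓ p q} → S Y C ℓ p ≡ true → outC Y C q ≡ true → R Y C ℓ q ≡ true → ¬ p <c q
    S-maximal {ℓ} {p} {q} Sp q∉C Rq p<q = true≢false (trans (sym some-above) none-above)
      where
      some-above : anyCell Y C (λ q → outC Y C q ∧ R Y C ℓ q ∧ (p <ᵇc q)) ≡ true
      some-above = T-true (any⁺ _ (lose (∈λ⇒∈cells Y (outC⇒∈λ Y C q∉C))
                     (true-T (cong₂ _∧_ q∉C (cong₂ _∧_ Rq (<c⇒<ᵇc p<q))))))
      none-above = not-injective (∧-conicalʳ (R Y C ℓ p) _ (∧-conicalʳ (outC Y C p) _ Sp))

    T⇒C : ∀ {ℓ p} → T Y C ℓ p ≡ true → C p ≡ true
    T⇒C {p = p} = ∧-conicalˡ (C p) _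

    T⇒R : ∀ {ℓ p} → T Y C ℓ p ≡ true → R Y C ℓ p ≡ true
    T⇒R {ℓ} {p} Tp = ∧-conicalˡ (R Y C ℓ p) _ (∧-conicalʳ (C p) _ Tp)

    diag-suc : ∀ s₁ s₂ → diag Y C (suc s₁ , suc s₂) ≡ diag Y C (s₁ , s₂)
    diag-suc s₁ s₂ = trans (ℤP.m-n≡m⊖n (suc s₁) (suc s₂))
                           (trans (ℤP.[1+m]⊖[1+n]≡m⊖n s₁ s₂) (sym (ℤP.m-n≡m⊖n s₁ s₂)))

    module BelowMaximal (up : IsUpSet Y C) {a b} (r-max : MaximalOutside Y C (a , b)) where

      r∈λ : mem (a , b) ≡ true
      r∈λ = ∧-conicalˡ (mem (a , b)) _ (proj₁ r-max)

      below-r⇒∉C : ∀ {u} → u ≤c (a , b) → C u ≡ false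
      below-r⇒∉C {u} u≤r with C u in u∈C
      ... | false = refl
      ... | true  = ⊥-elim (true≢false (trans (sym (proj₂ up u (a , b) u∈C u≤r r∈λ)) r∉C))
        where r∉C = not-injective (∧-conicalʳ (mem (a , b)) _ (proj₁ r-max))

      below-r⇒outC : ∀ {u} → 1 ℕ.≤ proj₁ u → 1 ℕ.≤ proj₂ u → u ≤c (a , b) → outC Y C u ≡ true
      below-r⇒outC {u} 1≤u₁ 1≤u₂ u≤r rewrite downClosed u (a , b) 1≤u₁ 1≤u₂ u≤r r∈λ | below-r⇒∉C u≤r = refl

      ∈λ-below-r⇒outC : ∀ {u} → mem u ≡ true → u ≤c (a , b) → outC Y C u ≡ true
      ∈λ-below-r⇒outC u∈λ = below-r⇒outC (proj₁ (∈λ⇒1≤ Y u∈λ)) (proj₂ (∈λ⇒1≤ Y u∈λ))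

      outC-between : ∀ {v z} → mem v ≡ true → v ≤c z → z ≤c (a , b) → outC Y C z ≡ true
      outC-between v∈λ (v₁≤z₁ , v₂≤z₂) =
        below-r⇒outC (ℕP.≤-trans (proj₁ (∈λ⇒1≤ Y v∈λ)) v₁≤z₁) (ℕP.≤-trans (proj₂ (∈λ⇒1≤ Y v∈λ)) v₂≤z₂)

      module _ {s₁ s₂} (s∈λ : mem (s₁ , s₂) ≡ true) (s′≤r : (suc s₁ , suc s₂) ≤c (a , b)) where

        private
          1≤s₁ = proj₁ (∈λ⇒1≤ Y s∈λ)
          1≤s₂ = proj₂ (∈λ⇒1≤ Y s∈λ)
          s≤s′ : (s₁ , s₂) ≤c (suc s₁ , suc s₂)
          s≤s′ = ℕP.n≤1+n s₁ , ℕP.n≤1+n s₂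
          s′∈λ : mem (suc s₁ , suc s₂) ≡ true
          s′∈λ = outC⇒∈λ Y C (below-r⇒outC (s≤s z≤n) (s≤s z≤n) s′≤r)

        -- The neighbours (s₁ + 1 , s₂) and (s₁ , s₂ + 1) lie in λ ∖ C above s, so maximality forces s = r_ℓ;
        -- but (s₁ + 1 , s₂ + 1) lies in λ on the same diagonal beyond r_ℓ.
        S-below-r : ∀ ℓ → S Y C ℓ (s₁ , s₂) ≢ true
        S-below-r ℓ Ss with R-elim (S⇒R Ss)
        ... | (ρ₁ , ρ₂) , rDiag≡ρ , _ , s₁≤ρ₁ , s₂≤ρ₂ = ℕP.<-irrefl s₁≡ρ₁ (s′-below-ρ (cong₂ _,_ s₁≡ρ₁ s₂≡ρ₂))
          where
          neighbour-not-below-ρ : ∀ {n} → (s₁ , s₂) <c n → n ≤c (a , b) → ¬ n ≤c (ρ₁ , ρ₂)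
          neighbour-not-below-ρ {n} s<n n≤r n≤ρ = S-maximal Ss n∉C (R-intro rDiag≡ρ (outC⇒∈λ Y C n∉C) n≤ρ) s<n
            where
            n∉C = outC-between s∈λ (proj₁ s<n) n≤r
          s₁≡ρ₁ : s₁ ≡ ρ₁
          s₁≡ρ₁ = ℕP.≤-antisym s₁≤ρ₁ (ℕP.≮⇒≥ λ s₁<ρ₁ → neighbour-not-below-ρ
            ((ℕP.n≤1+n s₁ , ℕP.≤-refl) , ℕP.<⇒≢ (ℕP.n<1+n s₁) ∘ cong proj₁)
            (≤c-trans (ℕP.≤-refl , ℕP.n≤1+n s₂) s′≤r) (s₁<ρ₁ , s₂≤ρ₂))
          s₂≡ρ₂ : s₂ ≡ ρ₂
          s₂≡ρ₂ = ℕP.≤-antisym s₂≤ρ₂ (ℕP.≮⇒≥ λ s₂<ρ₂ → neighbour-not-below-ρ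
            ((ℕP.≤-refl , ℕP.n≤1+n s₂) , ℕP.<⇒≢ (ℕP.n<1+n s₂) ∘ cong proj₂)
            (≤c-trans (ℕP.n≤1+n s₁ , ℕP.≤-refl) s′≤r) (s₁≤ρ₁ , s₂<ρ₂))
          s′-below-ρ : (s₁ , s₂) ≡ (ρ₁ , ρ₂) → suc s₁ ℕ.≤ ρ₁
          s′-below-ρ refl with rDiag-maximum rDiag≡ρ
          ... | s∈ℓ , maximum = maximum s′∈λ (trans (cong (λ z → does (z ℤ.≟ ℓ)) (diag-suc s₁ s₂)) s∈ℓ)

        Sbar-shift : ∀ ℓ → Sbar Y C ℓ (s₁ , s₂) ≡ Sbar Y C ℓ (suc s₁ , suc s₂)
        Sbar-shift ℓ = true⇔true⇒≡ to from
          where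
          S-shift : ∀ k → S Y C ℓ (s₁ + suc k , s₂ + suc k) ≡ S Y C ℓ (suc s₁ + k , suc s₂ + k)
          S-shift k = cong (S Y C ℓ) (cong₂ _,_ (ℕP.+-suc s₁ k) (ℕP.+-suc s₂ k))
          to : Sbar Y C ℓ (s₁ , s₂) ≡ true → Sbar Y C ℓ (suc s₁ , suc s₂) ≡ true
          to Sbar-s with any-upTo⁻ _ (suc m₁) (∧-conicalʳ (R Y C ℓ (s₁ , s₂)) _ Sbar-s)
          ... | zero  , _   , S-s  = ⊥-elim (S-below-r ℓ (subst (λ z → S Y C ℓ z ≡ true)
                                        (cong₂ _,_ (ℕP.+-identityʳ s₁) (ℕP.+-identityʳ s₂)) S-s))
          ... | suc k , k<m , S-sk = cong₂ _∧_
            (R-downClosed (S⇒R S-s′k) (s≤s z≤n) (s≤s z≤n) (s≤s (ℕP.m≤m+n s₁ k) , s≤s (ℕP.m≤m+n s₂ k)))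
            (any-upTo⁺ _ (ℕP.<-trans (ℕP.n<1+n k) k<m) S-s′k)
            where S-s′k = trans (sym (S-shift k)) S-sk
          from : Sbar Y C ℓ (suc s₁ , suc s₂) ≡ true → Sbar Y C ℓ (s₁ , s₂) ≡ true
          from Sbar-s′ with any-upTo⁻ _ (suc m₁) (∧-conicalʳ (R Y C ℓ (suc s₁ , suc s₂)) _ Sbar-s′)
          ... | k , _ , S-s′k = cong₂ _∧_
            (R-downClosed (∧-conicalˡ (R Y C ℓ (suc s₁ , suc s₂)) _ Sbar-s′) 1≤s₁ 1≤s₂ s≤s′)
            (any-upTo⁺ _ (s≤s (ℕP.≤-trans (ℕP.m≤n+m (suc k) s₁) (∈λ⇒≤m₁ (S⇒∈λ S-sk)))) S-sk)
            where S-sk = trans (S-shift k) S-s′k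

        Tbar-shift : ∀ ℓ → Tbar Y C ℓ (s₁ , s₂) ≡ Tbar Y C ℓ (suc s₁ , suc s₂)
        Tbar-shift ℓ = true⇔true⇒≡ to from
          where
          T-shift : ∀ k → T Y C ℓ (s₁ + suc (suc k) , s₂ + suc (suc k)) ≡ T Y C ℓ (suc s₁ + suc k , suc s₂ + suc k)
          T-shift k = cong (T Y C ℓ) (cong₂ _,_ (ℕP.+-suc s₁ (suc k)) (ℕP.+-suc s₂ (suc k)))
          to : Tbar Y C ℓ (s₁ , s₂) ≡ true → Tbar Y C ℓ (suc s₁ , suc s₂) ≡ true
          to Tbar-s with any-upTo⁻ _ m₁ (∧-conicalʳ (R Y C ℓ (s₁ , s₂)) _ Tbar-s)
          ... | zero  , _   , T-s′ = ⊥-elim (true≢false (trans (sym (T⇒C T-s′)) (below-r⇒∉C (subst (_≤c (a , b))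
                                        (sym (cong₂ _,_ (ℕP.+-comm s₁ 1) (ℕP.+-comm s₂ 1))) s′≤r))))
          ... | suc k , k<m , T-sk = cong₂ _∧_
            (R-downClosed (T⇒R T-s′k) (s≤s z≤n) (s≤s z≤n) (s≤s (ℕP.m≤m+n s₁ (suc k)) , s≤s (ℕP.m≤m+n s₂ (suc k))))
            (any-upTo⁺ _ (ℕP.<-trans (ℕP.n<1+n k) k<m) T-s′k)
            where T-s′k = trans (sym (T-shift k)) T-sk
          from : Tbar Y C ℓ (suc s₁ , suc s₂) ≡ true → Tbar Y C ℓ (s₁ , s₂) ≡ true
          from Tbar-s′ with any-upTo⁻ _ m₁ (∧-conicalʳ (R Y C ℓ (suc s₁ , suc s₂)) _ Tbar-s′)
          ... | k , _ , T-s′k = cong₂ _∧_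
            (R-downClosed (∧-conicalˡ (R Y C ℓ (suc s₁ , suc s₂)) _ Tbar-s′) 1≤s₁ 1≤s₂ s≤s′)
            (any-upTo⁺ _ (ℕP.≤-trans (ℕP.m≤n+m (suc (suc k)) s₁) (∈λ⇒≤m₁ (proj₁ up _ (T⇒C T-sk)))) T-sk)
            where T-sk = trans (T-shift k) T-s′k

      CR-below-r : ∀ ℓ {u} → u ≤c (a , b) → CR Y C ℓ u ≡ false
      CR-below-r ℓ u≤r rewrite below-r⇒∉C u≤r = refl

module DiagonalCells where

  open CellsOfYoungDiagrams
  open import Data.Nat as ℕ using (ℕ; zero; suc; _∸_; _≤_; _<_; z≤n; s≤s)
  import Data.Nat.Properties as ℕP
  open import Data.Product using (_×_; _,_; proj₁; proj₂)
  open import Data.Product.Properties using (≡-dec)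
  open import Data.Sum using (_⊎_; inj₁; inj₂; swap)
  open import Data.List using (upTo)
  open import Data.List.Membership.Propositional using (find; lose)
  open import Data.List.Membership.Propositional.Properties using (∈-upTo⁺; ∈-upTo⁻)
  open import Data.List.Relation.Unary.Any using (any?)
  open import Data.Empty using (⊥-elim)
  open import Relation.Binary.PropositionalEquality
  open import Relation.Nullary using (yes; no)
  open import Function using (_∘_)

  n<m⇒m∸n≡1+[m∸[1+n]] : ∀ {m n} → n < m → m ∸ n ≡ suc (m ∸ suc n)
  n<m⇒m∸n≡1+[m∸[1+n]] {suc m} {zero}  _         = refl
  n<m⇒m∸n≡1+[m∸[1+n]] {suc m} {suc n} (s≤s n<m) = n<m⇒m∸n≡1+[m∸[1+n]] n<m

  m∸n∸1≡m∸[1+n] : ∀ m n → m ∸ n ∸ 1 ≡ m ∸ suc n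
  m∸n∸1≡m∸[1+n] m n = trans (ℕP.∸-+-assoc m n 1) (cong (m ∸_) (ℕP.+-comm n 1))

  i≤m∸1⇒i<m : ∀ {i m} → 1 ≤ m → i ≤ m ∸ 1 → i < m
  i≤m∸1⇒i<m {m = suc m} _ i≤m = s≤s i≤m

  ≤c-cover-below : ∀ {u₁ u₂} v → v ≤c (suc u₁ , suc u₂) → v ≢ (suc u₁ , suc u₂) →
                   v ≤c (u₁ , suc u₂) ⊎ v ≤c (suc u₁ , u₂)
  ≤c-cover-below (v₁ , v₂) (v₁≤ , v₂≤) v≢ with ℕP.m≤n⇒m<n∨m≡n v₁≤ | ℕP.m≤n⇒m<n∨m≡n v₂≤
  ... | inj₁ v₁< | _        = inj₁ (ℕP.≤-pred v₁< , v₂≤)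
  ... | inj₂ _   | inj₁ v₂< = inj₂ (v₁≤ , ℕP.≤-pred v₂<)
  ... | inj₂ v₁≡ | inj₂ v₂≡ = ⊥-elim (v≢ (cong₂ _,_ v₁≡ v₂≡))

  ≤c-cover-above : ∀ {u₁ u₂} v → (u₁ , u₂) ≤c v → v ≢ (u₁ , u₂) →
                   (suc u₁ , u₂) ≤c v ⊎ (u₁ , suc u₂) ≤c v
  ≤c-cover-above (v₁ , v₂) (≤v₁ , ≤v₂) v≢ with ℕP.m≤n⇒m<n∨m≡n ≤v₁ | ℕP.m≤n⇒m<n∨m≡n ≤v₂
  ... | inj₁ <v₁ | _        = inj₁ (<v₁ , ≤v₂)
  ... | inj₂ _   | inj₁ <v₂ = inj₂ (≤v₁ , <v₂)
  ... | inj₂ ≡v₁ | inj₂ ≡v₂ = ⊥-elim (v≢ (sym (cong₂ _,_ ≡v₁ ≡v₂)))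

  module DiagonalFrom (a b i : ℕ) (i<a : i < a) (i<b : i < b) where

    at : ℕ → ℕ → Cell
    at s t = (a ∸ s , b ∸ t)

    cell above left : ℕ → Cell
    cell  m = at m m
    above m = at (suc m) m
    left  m = at m (suc m)

    at-injective : ∀ {s s′ t t′} → s ≤ suc i → s′ ≤ suc i → t ≤ suc i → t′ ≤ suc i →
                   at s t ≡ at s′ t′ → s ≡ s′ × t ≡ t′
    at-injective s≤ s′≤ t≤ t′≤ eq =
      ℕP.∸-cancelˡ-≡ (ℕP.≤-trans s≤ i<a) (ℕP.≤-trans s′≤ i<a) (cong proj₁ eq) ,
      ℕP.∸-cancelˡ-≡ (ℕP.≤-trans t≤ i<b) (ℕP.≤-trans t′≤ i<b) (cong proj₂ eq)

    at-antitone : ∀ {s s′ t t′} → s′ ≤ s → t′ ≤ t → at s t ≤c at s′ t′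
    at-antitone s′≤s t′≤t = ℕP.∸-monoʳ-≤ a s′≤s , ℕP.∸-monoʳ-≤ b t′≤t

    module _ {m} (m≤i : m ≤ i) where

      private
        a∸m≡ : a ∸ m ≡ suc (a ∸ suc m)
        a∸m≡ = n<m⇒m∸n≡1+[m∸[1+n]] (ℕP.≤-<-trans m≤i i<a)
        b∸m≡ : b ∸ m ≡ suc (b ∸ suc m)
        b∸m≡ = n<m⇒m∸n≡1+[m∸[1+n]] (ℕP.≤-<-trans m≤i i<b)

      cell-suc+1≡cell : (suc (a ∸ suc m) , suc (b ∸ suc m)) ≡ cell m
      cell-suc+1≡cell = sym (cong₂ _,_ a∸m≡ b∸m≡)

      cell-cover-below : ∀ v → v ≤c cell m → v ≢ cell m → v ≤c above m ⊎ v ≤c left m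
      cell-cover-below v v≤ v≢ rewrite a∸m≡ | b∸m≡ = ≤c-cover-below v v≤ v≢

      cell-cover-above : ∀ v → cell (suc m) ≤c v → v ≢ cell (suc m) → above m ≤c v ⊎ left m ≤c v
      cell-cover-above v ≤v v≢ rewrite a∸m≡ | b∸m≡ = swap (≤c-cover-above v ≤v v≢)

      1≤cell : 1 ≤ proj₁ (cell m) × 1 ≤ proj₂ (cell m)
      1≤cell rewrite a∸m≡ | b∸m≡ = s≤s z≤n , s≤s z≤n

      1≤above₂ : 1 ≤ proj₂ (above m)
      1≤above₂ rewrite b∸m≡ = s≤s z≤n

      1≤left₁ : 1 ≤ proj₁ (left m)
      1≤left₁ rewrite a∸m≡ = s≤s z≤n

    cell-injective : ∀ {m m′} → m ≤ suc i → m′ ≤ suc i → cell m ≡ cell m′ → m ≡ m′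
    cell-injective m≤ m′≤ = proj₁ ∘ at-injective m≤ m′≤ m≤ m′≤

    above-≢-cell : ∀ {n m} → n ≤ i → m ≤ suc i → above n ≢ cell m
    above-≢-cell n≤i m≤ eq with at-injective (s≤s n≤i) m≤ (ℕP.m≤n⇒m≤1+n n≤i) m≤ eq
    ... | refl , n≡1+n = ℕP.<⇒≢ (ℕP.n<1+n _) n≡1+n

    left-≢-cell : ∀ {n m} → n ≤ i → m ≤ suc i → left n ≢ cell m
    left-≢-cell n≤i m≤ eq with at-injective (ℕP.m≤n⇒m≤1+n n≤i) m≤ (s≤s n≤i) m≤ eq
    ... | refl , 1+n≡n = ℕP.<⇒≢ (ℕP.n<1+n _) (sym 1+n≡n)

    cell≤r : ∀ m → cell m ≤c (a , b)
    cell≤r m = at-antitone {m} {0} {m} {0} z≤n z≤n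

    above≤cell : ∀ m → above m ≤c cell m
    above≤cell m = at-antitone {suc m} {m} {m} {m} (ℕP.n≤1+n m) ℕP.≤-refl

    left≤cell : ∀ m → left m ≤c cell m
    left≤cell m = at-antitone {m} {m} {suc m} {m} ℕP.≤-refl (ℕP.n≤1+n m)

    cell-suc≤above : ∀ m → cell (suc m) ≤c above m
    cell-suc≤above m = at-antitone {suc m} {suc m} {suc m} {m} ℕP.≤-refl (ℕP.n≤1+n m)

    cell-suc≤left : ∀ m → cell (suc m) ≤c left m
    cell-suc≤left m = at-antitone {suc m} {m} {suc m} {suc m} (ℕP.n≤1+n m) ℕP.≤-refl

    data Position (p : Cell) : Set where
      top   : p ≡ cell 0 → Position p
      lower : ∀ {n} → n ≤ i → p ≡ cell (suc n) → Position p
      off   : (∀ {m} → m ≤ suc i → p ≢ cell m) → Position p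

    position : ∀ p → Position p
    position p with any? (λ m → ≡-dec ℕ._≟_ ℕ._≟_ p (cell m)) (upTo (suc (suc i)))
    ... | no  p∉ = off λ m≤ p≡ → p∉ (lose (∈-upTo⁺ (s≤s m≤)) p≡)
    ... | yes p∈ with find p∈
    ...   | zero  , _  , p≡ = top p≡
    ...   | suc n , n∈ , p≡ = lower (ℕP.≤-pred (ℕP.≤-pred (∈-upTo⁻ n∈))) p≡

module Mutations (Y : YoungDiagram) (a b i : ℕ) (i<a : i < a) (i<b : i < b) where

  open ListSums
  open CellsOfYoungDiagrams
  open RationalArithmetic
  open DiagonalCells
  open import Data.Nat using (ℕ; zero; suc; _≤_; _<_; z≤n; s≤s)
  import Data.Nat.Properties as ℕP
  open import Data.Rational using (ℚ; 0ℚ; _+_; _*_; _-_; -_; _⊓_)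
  import Data.Rational.Properties as ℚP
  open import Data.List using (downFrom)
  open import Relation.Binary.PropositionalEquality

  open YoungDiagram Y
  open DiagonalFrom a b i i<a i<b

  w : ℕ → Pt
  w m p = e Y (cell (suc m)) p - e Y (cell m) p

  minNeighbour : ℕ → Pt → ℚ
  minNeighbour m x = coord Y x (above m) ⊓ coord Y x (left m)

  φ≡ : ∀ m x p → φ Y a b m x p ≡ x p - minNeighbour m x * w m p
  φ≡ m x p rewrite m∸n∸1≡m∸[1+n] a m | m∸n∸1≡m∸[1+n] b m | dot-e Y x (above m) | dot-e Y x (left m) = refl

  φ-fixes : ∀ m x {u} → w m u ≡ 0ℚ → φ Y a b m x u ≡ x u
  φ-fixes m x {u} w≡0 = begin
    φ Y a b m x u                        ≡⟨ φ≡ m x u ⟩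
    x u - minNeighbour m x * w m u       ≡⟨ cong (λ v → x u - minNeighbour m x * v) w≡0 ⟩
    x u - minNeighbour m x * 0ℚ          ≡⟨ cong (λ v → x u - v) (ℚP.*-zeroʳ (minNeighbour m x)) ⟩
    x u - 0ℚ                             ≡⟨ ℚP.+-identityʳ (x u) ⟩
    x u                                  ∎
    where
    open ≡-Reasoning

  Φ-fixes : ∀ j x {u} → (∀ {m} → m ≤ j → w m u ≡ 0ℚ) → Φ Y a b j x u ≡ x u
  Φ-fixes zero    x w≡0 = φ-fixes zero x (w≡0 z≤n)
  Φ-fixes (suc j) x w≡0 =
    trans (φ-fixes (suc j) (Φ Y a b j x) (w≡0 ℕP.≤-refl)) (Φ-fixes j x λ m≤j → w≡0 (ℕP.m≤n⇒m≤1+n m≤j))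

  w-off : ∀ m {u} → u ≢ cell (suc m) → u ≢ cell m → w m u ≡ 0ℚ
  w-off m u≢cell-suc u≢cell rewrite e-off Y u≢cell-suc | e-off Y u≢cell = refl

  w-above : ∀ {m n} → m ≤ i → n ≤ i → w m (above n) ≡ 0ℚ
  w-above m≤i n≤i = w-off _ (above-≢-cell n≤i (s≤s m≤i)) (above-≢-cell n≤i (ℕP.m≤n⇒m≤1+n m≤i))

  w-left : ∀ {m n} → m ≤ i → n ≤ i → w m (left n) ≡ 0ℚ
  w-left m≤i n≤i = w-off _ (left-≢-cell n≤i (s≤s m≤i)) (left-≢-cell n≤i (ℕP.m≤n⇒m≤1+n m≤i))

  minNeighbour-Φ : ∀ {j n} → j ≤ i → n ≤ i → ∀ x → minNeighbour n (Φ Y a b j x) ≡ minNeighbour n x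
  minNeighbour-Φ {j} {n} j≤i n≤i x = cong₂ _⊓_
    (coord-cong Y {Φ Y a b j x} {x} (above n) (Φ-fixes j x λ m≤j → w-above (ℕP.≤-trans m≤j j≤i) n≤i))
    (coord-cong Y {Φ Y a b j x} {x} (left n)  (Φ-fixes j x λ m≤j → w-left  (ℕP.≤-trans m≤j j≤i) n≤i))

  Φ-formula : ∀ j → j ≤ i → ∀ x p →
              Φ Y a b j x p ≡ x p - sumWith (λ m → minNeighbour m x * w m p) (downFrom (suc j))
  Φ-formula zero    _   x p = trans (φ≡ zero x p) (cong (λ v → x p - v) (sym (ℚP.+-identityʳ _)))
  Φ-formula (suc j) j<i x p = begin
    φ Y a b (suc j) (Φ Y a b j x) p                          ≡⟨ φ≡ (suc j) (Φ Y a b j x) p ⟩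
    Φ Y a b j x p - minNeighbour (suc j) (Φ Y a b j x) * w (suc j) p
      ≡⟨ cong₂ (λ u v → u - v * w (suc j) p) (Φ-formula j j≤i x p) (minNeighbour-Φ j≤i j<i x) ⟩
    (x p - earlier) - minNeighbour (suc j) x * w (suc j) p    ≡⟨ [p-q]-r≡p-[r+q] (x p) earlier _ ⟩
    x p - (minNeighbour (suc j) x * w (suc j) p + earlier)   ∎
    where
    open ≡-Reasoning
    j≤i = ℕP.<⇒≤ j<i
    earlier = sumWith (λ m → minNeighbour m x * w m p) (downFrom (suc j))

module DiagonalLift (Y : YoungDiagram) (C : Cell → Bool) (up : IsUpSet Y C) {a b} (r-max : MaximalOutside Y C (a , b))
         (i : ℕ) (i<a : i < a) (i<b : i < b) where

  open ListSums
  open RationalArithmetic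
  open CellsOfYoungDiagrams
  open ScaledChainOrders
  open DiagonalConstraints
  open DiagonalCells
  open import Data.Bool using (Bool; true; false; if_then_else_)
  open import Data.Integer using (ℤ)
  open import Data.Nat as ℕ using (ℕ; zero; suc; _∸_; _≤_; _<_; z≤n; s≤s)
  import Data.Nat.Properties as ℕP
  open import Data.Rational using (ℚ; 0ℚ; 1ℚ; _+_; _*_; _-_; _⊓_) renaming (_≤_ to _≤ℚ_)
  import Data.Rational.Properties as ℚP
  open import Data.List using ([]; _∷_; downFrom; filterᵇ)
  open import Data.List.Membership.Propositional using (_∈_)
  open import Data.List.Membership.Propositional.Properties using (∈-downFrom⁺; ∈-downFrom⁻)
  open import Data.Product using (_×_; _,_; proj₁; proj₂)
  open import Data.Sum using (inj₁; inj₂)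
  open import Data.Product.Properties using (≡-dec)
  open import Data.Empty using (⊥-elim)
  open import Relation.Binary.PropositionalEquality
  open import Relation.Nullary using (yes; no)
  open import Function using (_∘_)
  open import Data.List.Relation.Unary.Unique.Propositional.Properties using (downFrom⁺)

  open YoungDiagram Y
  open DiagonalFrom a b i i<a i<b
  open BelowMaximal Y C up r-max
  open Mutations Y a b i i<a i<b

  cell-outC : ∀ {m} → m ≤ i → outC Y C (cell m) ≡ true
  cell-outC {m} m≤i = below-r⇒outC (proj₁ (1≤cell m≤i)) (proj₂ (1≤cell m≤i)) (cell≤r m)

  module _ {m} (m≤i : m ≤ i) (cell-suc∈λ : mem (cell (suc m)) ≡ true) where

    above-outC : outC Y C (above m) ≡ true
    above-outC = below-r⇒outC (proj₁ (∈λ⇒1≤ Y cell-suc∈λ)) (1≤above₂ m≤i) (≤c-trans (above≤cell m) (cell≤r m))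

    left-outC : outC Y C (left m) ≡ true
    left-outC = below-r⇒outC (1≤left₁ m≤i) (proj₂ (∈λ⇒1≤ Y cell-suc∈λ)) (≤c-trans (left≤cell m) (cell≤r m))

  module _ {K v} (v∈ : ScaledChainOrder Y C K v) where

    private
      mono = proj₁ (proj₂ v∈)

    coord-mono-below-r : ∀ {u w} → outC Y C w ≡ true → u ≤c w → w ≤c (a , b) → coord Y v u ≤ℚ v w
    coord-mono-below-r {u} {w} w∉C u≤w w≤r with mem u in u∈λ
    ... | true  = mono u w (∈λ-below-r⇒outC u∈λ (≤c-trans u≤w w≤r)) w∉C u≤w
    ... | false = proj₁ (proj₁ v∈ w (outC⇒∈λ Y C w∉C))

    above+left≤cell+minNeighbour : ∀ {m} → m ≤ i →
      coord Y v (above m) + coord Y v (left m) ≤ℚ v (cell m) + minNeighbour m v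
    above+left≤cell+minNeighbour {m} m≤i = p+q≤r+p⊓q
      (coord-mono-below-r (cell-outC m≤i) (above≤cell m) (cell≤r m))
      (coord-mono-below-r (cell-outC m≤i) (left≤cell m) (cell≤r m))

    cell-suc≤minNeighbour : ∀ {m} → m ≤ i → mem (cell (suc m)) ≡ true →
      v (cell (suc m)) ≤ℚ minNeighbour m v
    cell-suc≤minNeighbour {m} m≤i cell-suc∈λ = ℚP.⊓-glb
      (subst (v (cell (suc m)) ≤ℚ_) (sym (coord-∈ Y v (outC⇒∈λ Y C (above-outC m≤i cell-suc∈λ))))
        (mono _ _ (∈λ-below-r⇒outC cell-suc∈λ (cell≤r (suc m))) (above-outC m≤i cell-suc∈λ) (cell-suc≤above m)))
      (subst (v (cell (suc m)) ≤ℚ_) (sym (coord-∈ Y v (outC⇒∈λ Y C (left-outC m≤i cell-suc∈λ))))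
        (mono _ _ (∈λ-below-r⇒outC cell-suc∈λ (cell≤r (suc m))) (left-outC m≤i cell-suc∈λ) (cell-suc≤left m)))

    minNeighbour-absent : ∀ {m} → mem (cell (suc m)) ≡ false → minNeighbour m v ≡ 0ℚ
    minNeighbour-absent {m} cell-suc∉λ with a ∸ suc m ℕ.≟ 0 | b ∸ suc m ℕ.≟ 0
    ... | yes a∸≡0 | _ = begin
      coord Y v (above m) ⊓ coord Y v (left m) ≡⟨ cong (_⊓ coord Y v (left m)) (coord-∉ Y v above∉λ) ⟩
      0ℚ ⊓ coord Y v (left m)                  ≡⟨ ℚP.p≤q⇒p⊓q≡p (coord-nonneg Y C v∈ (left m)) ⟩
      0ℚ                                       ∎
      where
      open ≡-Reasoning
      above∉λ = subst (λ z → mem (z , b ∸ m) ≡ false) (sym a∸≡0) (0,y∉λ Y (b ∸ m))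
    ... | no _ | yes b∸≡0 = begin
      coord Y v (above m) ⊓ coord Y v (left m) ≡⟨ cong (coord Y v (above m) ⊓_) (coord-∉ Y v left∉λ) ⟩
      coord Y v (above m) ⊓ 0ℚ                 ≡⟨ ℚP.p≥q⇒p⊓q≡q (coord-nonneg Y C v∈ (above m)) ⟩
      0ℚ                                       ∎
      where
      open ≡-Reasoning
      left∉λ = subst (λ z → mem (a ∸ m , z) ≡ false) (sym b∸≡0) (x,0∉λ Y (a ∸ m))
    ... | no a∸≢0 | no b∸≢0 = ⊥-elim (true≢false (trans (sym cell-suc∈λ) cell-suc∉λ))
      where
      cell-suc∈λ = downClosed (cell (suc m)) (a , b) (ℕP.n≢0⇒n>0 a∸≢0) (ℕP.n≢0⇒n>0 b∸≢0) (cell≤r (suc m)) r∈λ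

  module _ (ℓ : ℤ) {m} (m≤i : m ≤ i) (cell-suc∈λ : mem (cell (suc m)) ≡ true) where

    private
      cell-suc+1≤r : (suc (a ∸ suc m) , suc (b ∸ suc m)) ≤c (a , b)
      cell-suc+1≤r = subst (_≤c (a , b)) (sym (cell-suc+1≡cell m≤i)) (cell≤r m)

    Sbar-agrees : Sbar Y C ℓ (cell (suc m)) ≡ Sbar Y C ℓ (cell m)
    Sbar-agrees = trans (Sbar-shift cell-suc∈λ cell-suc+1≤r ℓ) (cong (Sbar Y C ℓ) (cell-suc+1≡cell m≤i))

    Tbar-agrees : Tbar Y C ℓ (cell (suc m)) ≡ Tbar Y C ℓ (cell m)
    Tbar-agrees = trans (Tbar-shift cell-suc∈λ cell-suc+1≤r ℓ) (cong (Tbar Y C ℓ) (cell-suc+1≡cell m≤i))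

    CR-agrees : CR Y C ℓ (cell (suc m)) ≡ CR Y C ℓ (cell m)
    CR-agrees = trans (CR-below-r ℓ (cell≤r (suc m))) (sym (CR-below-r ℓ (cell≤r m)))

  module ConvexLift {K x x′} (x∈ : ScaledChainOrder Y C K x) (x′∈ : ScaledChainOrder Y C K x′)
                    {t} (0≤t : 0ℚ ≤ℚ t) (t≤1 : t ≤ℚ 1ℚ) where

    u : ℚ
    u = 1ℚ - t

    0≤u : 0ℚ ≤ℚ u
    0≤u = p≤q⇒0≤q-p t≤1

    X : Pt
    X p = t * x p + u * x′ p

    X∈ : ScaledChainOrder Y C K X
    X∈ = ScaledChainOrder-convex Y C 0≤t t≤1 x∈ x′∈

    mixedMin : ℕ → ℚ
    mixedMin m = t * minNeighbour m x + u * minNeighbour m x′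

    δ : ℕ → ℚ
    δ m = minNeighbour m X - mixedMin m

    lift : Pt
    lift p = X p + sumWith (λ m → δ m * w m p) (downFrom (suc i))

    coord-X : ∀ v → coord Y X v ≡ t * coord Y x v + u * coord Y x′ v
    coord-X v with mem v
    ... | true  = refl
    ... | false = sym (trans (cong₂ _+_ (ℚP.*-zeroʳ t) (ℚP.*-zeroʳ u)) (ℚP.+-identityʳ 0ℚ))

    0≤δ : ∀ m → 0ℚ ≤ℚ δ m
    0≤δ m = p≤q⇒0≤q-p (subst (mixedMin m ≤ℚ_) (sym (cong₂ _⊓_ (coord-X (above m)) (coord-X (left m))))
                        (⊓-concave _ _ _ _ 0≤t 0≤u))

    lift-fixes : ∀ {v} → (∀ {m} → m ≤ i → w m v ≡ 0ℚ) → lift v ≡ X v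
    lift-fixes {v} w≡0 = trans (cong (X v +_) (sumWith-zero δw≡0)) (ℚP.+-identityʳ (X v))
      where
      δw≡0 : ∀ {m} → m ∈ downFrom (suc i) → δ m * w m v ≡ 0ℚ
      δw≡0 {m} m∈ = trans (cong (δ m *_) (w≡0 (ℕP.≤-pred (∈-downFrom⁻ m∈)))) (ℚP.*-zeroʳ (δ m))

    minNeighbour-lift : ∀ {m} → m ≤ i → minNeighbour m lift ≡ minNeighbour m X
    minNeighbour-lift {m} m≤i = cong₂ _⊓_
      (coord-cong Y {lift} {X} (above m) (lift-fixes λ n≤i → w-above n≤i m≤i))
      (coord-cong Y {lift} {X} (left m)  (lift-fixes λ n≤i → w-left  n≤i m≤i))

    Φ-lift : ∀ p → Φ Y a b i lift p ≡ t * Φ Y a b i x p + u * Φ Y a b i x′ p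
    Φ-lift p = begin
      Φ Y a b i lift p                                   ≡⟨ Φ-formula i ℕP.≤-refl lift p ⟩
      lift p - sumWith (λ m → minNeighbour m lift * w m p) ms
        ≡⟨ cong (λ s → lift p - s) (sumWith-cong {xs = ms} λ {m} m∈ →
             cong (_* w m p) (minNeighbour-lift (ℕP.≤-pred (∈-downFrom⁻ m∈)))) ⟩
      lift p - sumWith (λ m → minNeighbour m X * w m p) ms
        ≡⟨ cong (λ s → lift p - s) (sumWith-cong {xs = ms} λ {m} _ → split m) ⟩
      lift p - sumWith (λ m → δ m * w m p + (t * (minNeighbour m x * w m p) + u * (minNeighbour m x′ * w m p))) ms
        ≡⟨ cong (λ s → lift p - s) sum-split ⟩
      lift p - (D + (t * A + u * B))                     ≡⟨ rearrange t (x p) (x′ p) D A B ⟩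
      t * (x p - A) + u * (x′ p - B)                     ≡⟨ cong₂ (λ v v′ → t * v + u * v′) (Φ-formula i ℕP.≤-refl x p)
                                                                                        (Φ-formula i ℕP.≤-refl x′ p) ⟨
      t * Φ Y a b i x p + u * Φ Y a b i x′ p             ∎
      where
      open ≡-Reasoning
      open import Data.Rational.Solver using (module +-*-Solver)
      open +-*-Solver
      ms = downFrom (suc i)
      D = sumWith (λ m → δ m * w m p) ms
      A = sumWith (λ m → minNeighbour m x * w m p) ms
      B = sumWith (λ m → minNeighbour m x′ * w m p) ms
      split : ∀ m → minNeighbour m X * w m p ≡
                    δ m * w m p + (t * (minNeighbour m x * w m p) + u * (minNeighbour m x′ * w m p))
      split m = solve 6 (λ M Mx Mx′ t u w → M :* w := (M :- (t :* Mx :+ u :* Mx′)) :* w :+ (t :* (Mx :* w) :+ u :* (Mx′ :* w)))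
                  refl (minNeighbour m X) (minNeighbour m x) (minNeighbour m x′) t u (w m p)
      sum-split : sumWith (λ m → δ m * w m p + (t * (minNeighbour m x * w m p) + u * (minNeighbour m x′ * w m p))) ms
                  ≡ D + (t * A + u * B)
      Mx·w Mx′·w : ℕ → ℚ
      Mx·w m = minNeighbour m x * w m p
      Mx′·w m = minNeighbour m x′ * w m p
      sum-split = trans (sumWith-+ (λ m → δ m * w m p) (λ m → t * Mx·w m + u * Mx′·w m) ms)
                   (cong (D +_) (trans (sumWith-+ (λ m → t * Mx·w m) (λ m → u * Mx′·w m) ms)
                     (cong₂ _+_ (sumWith-*ˡ t Mx·w ms) (sumWith-*ˡ u Mx′·w ms))))
      rearrange : ∀ t y y′ D A B → (t * y + (1ℚ - t) * y′ + D) - (D + (t * A + (1ℚ - t) * B)) ≡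
                                   t * (y - A) + (1ℚ - t) * (y′ - B)
      rearrange = solve 6 (λ t y y′ D A B → (t :* y :+ (con 1ℚ :- t) :* y′ :+ D) :- (D :+ (t :* A :+ (con 1ℚ :- t) :* B)) :=
                                             t :* (y :- A) :+ (con 1ℚ :- t) :* (y′ :- B)) refl

    -- flow suc v is the mass the lift moves into v, flow (λ m → m) v the mass it moves out of v.
    flow : (ℕ → ℕ) → Cell → ℚ
    flow g v = sumWith (λ m → δ m * e Y (cell (g m)) v) (downFrom (suc i))

    lift≡X+flows : ∀ v → lift v ≡ X v + (flow suc v - flow (λ m → m) v)
    lift≡X+flows v = cong (X v +_) (trans (sumWith-cong {xs = downFrom (suc i)} λ {m} _ → *-distribˡ-sub (δ m) _ _)
      (sumWith-sub (λ m → δ m * e Y (cell (suc m)) v) (λ m → δ m * e Y (cell m) v) (downFrom (suc i))))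

    flow-absent : ∀ g {v} → (∀ {m} → m ≤ i → cell (g m) ≢ v) → flow g v ≡ 0ℚ
    flow-absent g ≢v = sumWith-zero λ {m} m∈ →
      trans (cong (δ m *_) (e-off Y (≢v (ℕP.≤-pred (∈-downFrom⁻ m∈)) ∘ sym))) (ℚP.*-zeroʳ (δ m))

    flow-single : ∀ g {n v} → n ≤ i → mem v ≡ true → cell (g n) ≡ v →
                  (∀ {m} → m ≤ i → m ≢ n → cell (g m) ≢ v) → flow g v ≡ δ n
    flow-single g {n} {v} n≤i v∈λ refl ≢v =
      trans (sumWith-single (downFrom⁺ (suc i)) (∈-downFrom⁺ (s≤s n≤i)) δe≡0)
            (trans (cong (δ n *_) (e-diag Y v∈λ)) (ℚP.*-identityʳ (δ n)))
      where
      δe≡0 : ∀ {m} → m ∈ downFrom (suc i) → m ≢ n → δ m * e Y (cell (g m)) v ≡ 0ℚ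
      δe≡0 {m} m∈ m≢n =
        trans (cong (δ m *_) (e-off Y (≢v (ℕP.≤-pred (∈-downFrom⁻ m∈)) m≢n ∘ sym))) (ℚP.*-zeroʳ (δ m))

    incoming : ℕ → ℚ
    incoming zero    = 0ℚ
    incoming (suc n) = δ n

    0≤incoming : ∀ m → 0ℚ ≤ℚ incoming m
    0≤incoming zero    = ℚP.≤-refl
    0≤incoming (suc n) = 0≤δ n

    cell-∈λ : ∀ {m} → m ≤ i → mem (cell m) ≡ true
    cell-∈λ m≤i = outC⇒∈λ Y C (cell-outC m≤i)

    lift-cell : ∀ {m} → m ≤ i → lift (cell m) ≡ X (cell m) + (incoming m - δ m)
    lift-cell {m} m≤i = trans (lift≡X+flows (cell m)) (cong₂ (λ f f′ → X (cell m) + (f - f′)) (inflow m m≤i) outflow)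
      where
      outflow : flow (λ m → m) (cell m) ≡ δ m
      outflow = flow-single (λ m → m) m≤i (cell-∈λ m≤i) refl
        λ m′≤i m′≢m eq → m′≢m (cell-injective (ℕP.m≤n⇒m≤1+n m′≤i) (ℕP.m≤n⇒m≤1+n m≤i) eq)
      inflow : ∀ m → m ≤ i → flow suc (cell m) ≡ incoming m
      inflow zero    _    = flow-absent suc λ m′≤i eq → ℕP.1+n≢0 (cell-injective (s≤s m′≤i) z≤n eq)
      inflow (suc n) n<i  = flow-single suc (ℕP.<⇒≤ n<i) (cell-∈λ n<i) refl
        λ m′≤i m′≢n eq → m′≢n (ℕP.suc-injective (cell-injective (s≤s m′≤i) n<i′ eq))
        where n<i′ = ℕP.m≤n⇒m≤1+n n<i

    lift-bottom : mem (cell (suc i)) ≡ true → lift (cell (suc i)) ≡ X (cell (suc i)) + δ i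
    lift-bottom cell-suc∈λ = trans (lift≡X+flows (cell (suc i)))
      (cong (X (cell (suc i)) +_) (trans (cong₂ _-_ inflow outflow) (ℚP.+-identityʳ (δ i))))
      where
      inflow : flow suc (cell (suc i)) ≡ δ i
      inflow = flow-single suc ℕP.≤-refl cell-suc∈λ refl
        λ m≤i m≢i eq → m≢i (ℕP.suc-injective (cell-injective (s≤s m≤i) ℕP.≤-refl eq))
      outflow : flow (λ m → m) (cell (suc i)) ≡ 0ℚ
      outflow = flow-absent (λ m → m) λ m≤i eq →
        ℕP.<-irrefl (cell-injective (ℕP.m≤n⇒m≤1+n m≤i) ℕP.≤-refl eq) (s≤s m≤i)

    lift-off : ∀ {v} → (∀ {m} → m ≤ suc i → v ≢ cell m) → lift v ≡ X v
    lift-off v-off = lift-fixes λ m≤i → w-off _ (v-off (s≤s m≤i)) (v-off (ℕP.m≤n⇒m≤1+n m≤i))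

    X-δ≤lift-cell : ∀ {m} → m ≤ i → X (cell m) - δ m ≤ℚ lift (cell m)
    X-δ≤lift-cell {m} m≤i =
      subst (X (cell m) - δ m ≤ℚ_) (sym (lift-cell m≤i)) (p-r≤p+[q-r] (X (cell m)) (δ m) (0≤incoming m))

    lift-top≤X : lift (cell 0) ≤ℚ X (cell 0)
    lift-top≤X = subst₂ _≤ℚ_ (sym (lift-cell z≤n)) (ℚP.+-identityʳ (X (cell 0))) (p+[q-r]≤p+q (X (cell 0)) 0ℚ (0≤δ 0))

    lift-cell-suc≤X+δ : ∀ {m} → m ≤ i → mem (cell (suc m)) ≡ true → lift (cell (suc m)) ≤ℚ X (cell (suc m)) + δ m
    lift-cell-suc≤X+δ {m} m≤i cell-suc∈λ with m ℕ.≟ i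
    ... | yes refl = ℚP.≤-reflexive (lift-bottom cell-suc∈λ)
    ... | no  m≢i  = subst (_≤ℚ X (cell (suc m)) + δ m) (sym (lift-cell (ℕP.≤∧≢⇒< m≤i m≢i)))
                       (p+[q-r]≤p+q (X (cell (suc m))) (δ m) (0≤δ (suc m)))

    X≤lift-bottom : mem (cell (suc i)) ≡ true → X (cell (suc i)) ≤ℚ lift (cell (suc i))
    X≤lift-bottom cell-suc∈λ = subst (X (cell (suc i)) ≤ℚ_) (sym (lift-bottom cell-suc∈λ)) (p≤p+q _ (0≤δ i))

    neighbours≤lift-cell : ∀ {m} → m ≤ i → coord Y X (above m) ≤ℚ lift (cell m) × coord Y X (left m) ≤ℚ lift (cell m)
    neighbours≤lift-cell {m} m≤i =
      bound (ℚP.≤-trans (ℚP.+-monoʳ-≤ A (ℚP.p⊓q≤q A L)) A+L≤) ,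
      bound (ℚP.≤-trans (ℚP.+-monoʳ-≤ L (ℚP.p⊓q≤p A L)) (subst (_≤ℚ X (cell m) + mixedMin m) (ℚP.+-comm A L) A+L≤))
      where
      A = coord Y X (above m)
      L = coord Y X (left m)
      A+L≤ : A + L ≤ℚ X (cell m) + mixedMin m
      A+L≤ = subst₂ _≤ℚ_
        (trans (combination-+ t u (coord Y x (above m)) (coord Y x (left m)) (coord Y x′ (above m)) (coord Y x′ (left m)))
               (sym (cong₂ _+_ (coord-X (above m)) (coord-X (left m)))))
        (combination-+ t u (x (cell m)) (minNeighbour m x) (x′ (cell m)) (minNeighbour m x′))
        (combination-mono-≤ 0≤t 0≤u (above+left≤cell+minNeighbour x∈ m≤i) (above+left≤cell+minNeighbour x′∈ m≤i))
      bound : ∀ {N} → N + minNeighbour m X ≤ℚ X (cell m) + mixedMin m → N ≤ℚ lift (cell m)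
      bound N+M≤ = ℚP.≤-trans (p+q≤r+s⇒p≤r-[q-s] {r = X (cell m)} {s = mixedMin m} N+M≤) (X-δ≤lift-cell m≤i)

    lift-cell-suc≤minNeighbour : ∀ {m} → m ≤ i → mem (cell (suc m)) ≡ true →
                                 lift (cell (suc m)) ≤ℚ minNeighbour m X
    lift-cell-suc≤minNeighbour {m} m≤i cell-suc∈λ = ℚP.≤-trans (lift-cell-suc≤X+δ m≤i cell-suc∈λ)
      (subst (X (cell (suc m)) + δ m ≤ℚ_) (p+[q-p]≡q (mixedMin m) (minNeighbour m X)) (ℚP.+-monoˡ-≤ (δ m) X≤mixedMin))
      where
      X≤mixedMin : X (cell (suc m)) ≤ℚ mixedMin m
      X≤mixedMin = combination-mono-≤ 0≤t 0≤u (cell-suc≤minNeighbour x∈ m≤i cell-suc∈λ)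
                                              (cell-suc≤minNeighbour x′∈ m≤i cell-suc∈λ)

    private
      X-bounds = proj₁ X∈
      X-mono   = proj₁ (proj₂ X∈)
      X-chain  = proj₂ (proj₂ X∈)

    lift-cell-suc≤X-above : ∀ {n} → n ≤ i → mem (cell (suc n)) ≡ true → lift (cell (suc n)) ≤ℚ X (above n)
    lift-cell-suc≤X-above {n} n≤i cell-suc∈λ = ℚP.≤-trans (lift-cell-suc≤minNeighbour n≤i cell-suc∈λ)
      (ℚP.≤-trans (ℚP.p⊓q≤p (coord Y X (above n)) (coord Y X (left n))) (ℚP.≤-reflexive (coord-∈ Y X (outC⇒∈λ Y C (above-outC n≤i cell-suc∈λ)))))

    lift-cell-suc≤X-left : ∀ {n} → n ≤ i → mem (cell (suc n)) ≡ true → lift (cell (suc n)) ≤ℚ X (left n)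
    lift-cell-suc≤X-left {n} n≤i cell-suc∈λ = ℚP.≤-trans (lift-cell-suc≤minNeighbour n≤i cell-suc∈λ)
      (ℚP.≤-trans (ℚP.p⊓q≤q (coord Y X (above n)) (coord Y X (left n))) (ℚP.≤-reflexive (coord-∈ Y X (outC⇒∈λ Y C (left-outC n≤i cell-suc∈λ)))))

    lift-bounds : ∀ p → mem p ≡ true → (0ℚ ≤ℚ lift p) × (lift p ≤ℚ K)
    lift-bounds p p∈λ with position p
    ... | top refl =
      ℚP.≤-trans (coord-nonneg Y C X∈ (above 0)) (proj₁ (neighbours≤lift-cell z≤n)) ,
      ℚP.≤-trans lift-top≤X (proj₂ (X-bounds _ p∈λ))
    ... | lower {n} n≤i refl = lower-bound , ℚP.≤-trans (lift-cell-suc≤X-above n≤i p∈λ)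
                                                      (proj₂ (X-bounds _ (outC⇒∈λ Y C (above-outC n≤i p∈λ))))
      where
      lower-bound : 0ℚ ≤ℚ lift (cell (suc n))
      lower-bound with n ℕ.≟ i
      ... | yes refl = ℚP.≤-trans (proj₁ (X-bounds _ p∈λ)) (X≤lift-bottom p∈λ)
      ... | no  n≢i  = ℚP.≤-trans (coord-nonneg Y C X∈ (above (suc n))) (proj₁ (neighbours≤lift-cell (ℕP.≤∧≢⇒< n≤i n≢i)))
    ... | off p-off = subst (λ v → (0ℚ ≤ℚ v) × (v ≤ℚ K)) (sym (lift-off p-off)) (X-bounds p p∈λ)

    X-below-cell≤lift : ∀ {m v} → m ≤ i → outC Y C v ≡ true → v ≤c cell m → v ≢ cell m → X v ≤ℚ lift (cell m)
    X-below-cell≤lift {m} {v} m≤i v∉C v≤cell v≢cell with cell-cover-below m≤i v v≤cell v≢cell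
    ... | inj₁ v≤above = ℚP.≤-trans (X-mono v (above m) v∉C above∉C v≤above)
        (subst (_≤ℚ lift (cell m)) (coord-∈ Y X (outC⇒∈λ Y C above∉C)) (proj₁ (neighbours≤lift-cell m≤i)))
      where above∉C = outC-between (outC⇒∈λ Y C v∉C) v≤above (≤c-trans (above≤cell m) (cell≤r m))
    ... | inj₂ v≤left = ℚP.≤-trans (X-mono v (left m) v∉C left∉C v≤left)
        (subst (_≤ℚ lift (cell m)) (coord-∈ Y X (outC⇒∈λ Y C left∉C)) (proj₂ (neighbours≤lift-cell m≤i)))
      where left∉C = outC-between (outC⇒∈λ Y C v∉C) v≤left (≤c-trans (left≤cell m) (cell≤r m))

    X≤lift : ∀ {v q} → outC Y C v ≡ true → outC Y C q ≡ true → v ≤c q → (∀ {m} → m ≤ suc i → v ≢ cell m) →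
             X v ≤ℚ lift q
    X≤lift {v} {q} v∉C q∉C v≤q v-off with position q
    ... | top refl = X-below-cell≤lift z≤n v∉C v≤q (v-off z≤n)
    ... | lower {n} n≤i refl with n ℕ.≟ i
    ...   | yes refl = ℚP.≤-trans (X-mono v q v∉C q∉C v≤q) (X≤lift-bottom (outC⇒∈λ Y C q∉C))
    ...   | no  n≢i  = X-below-cell≤lift (ℕP.≤∧≢⇒< n≤i n≢i) v∉C v≤q (v-off (s≤s n≤i))
    X≤lift {v} {q} v∉C q∉C v≤q v-off | off q-off =
      subst (X v ≤ℚ_) (sym (lift-off q-off)) (X-mono v q v∉C q∉C v≤q)

    lift-cell-suc≤lift : ∀ {n q} → n ≤ i → mem (cell (suc n)) ≡ true → outC Y C q ≡ true →
                         cell (suc n) ≤c q → q ≢ cell (suc n) → lift (cell (suc n)) ≤ℚ lift q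
    lift-cell-suc≤lift {n} {q} n≤i cell-suc∈λ q∉C cell-suc≤q q≢ with cell-cover-above n≤i q cell-suc≤q q≢
    ... | inj₁ above≤q = ℚP.≤-trans (lift-cell-suc≤X-above n≤i cell-suc∈λ)
                           (X≤lift (above-outC n≤i cell-suc∈λ) q∉C above≤q (above-≢-cell n≤i))
    ... | inj₂ left≤q  = ℚP.≤-trans (lift-cell-suc≤X-left n≤i cell-suc∈λ)
                           (X≤lift (left-outC n≤i cell-suc∈λ) q∉C left≤q (left-≢-cell n≤i))

    lift-mono : ∀ p q → outC Y C p ≡ true → outC Y C q ≡ true → p ≤c q → lift p ≤ℚ lift q
    lift-mono p q p∉C q∉C p≤q with ≡-dec ℕ._≟_ ℕ._≟_ p q
    ... | yes refl = ℚP.≤-refl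
    ... | no p≢q with position p
    ...   | top refl        = ⊥-elim (p≢q (sym (proj₂ r-max q q∉C p≤q)))
    ...   | lower n≤i refl  = lift-cell-suc≤lift n≤i (outC⇒∈λ Y C p∉C) q∉C p≤q (p≢q ∘ sym)
    ...   | off p-off       = subst (_≤ℚ lift q) (sym (lift-off p-off)) (X≤lift p∉C q∉C p≤q p-off)

    private
      ∈C⇒off : ∀ {q} → C q ≡ true → ∀ {m} → q ≢ cell m
      ∈C⇒off q∈C {m} refl = true≢false (trans (sym q∈C) (below-r⇒∉C (cell≤r m)))

    sumList-lift : ∀ p qs → ChainInC Y C p qs → sumList Y C lift qs ≡ sumList Y C X qs
    sumList-lift p []       _                = refl
    sumList-lift p (q ∷ qs) (_ , q∈C , ch) = cong₂ _+_ (lift-off λ {m} _ → ∈C⇒off q∈C {m}) (sumList-lift q qs ch)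

    lift-chain : ∀ p qs → outC Y C p ≡ true → ChainInC Y C p qs → lift p + sumList Y C lift qs ≤ℚ K
    lift-chain p qs p∉C ch rewrite sumList-lift p qs ch with position p
    ... | top refl = ℚP.≤-trans (ℚP.+-monoˡ-≤ _ lift-top≤X) (X-chain p qs p∉C ch)
    ... | off p-off = subst (λ v → v + sumList Y C X qs ≤ℚ K) (sym (lift-off p-off)) (X-chain p qs p∉C ch)
    ... | lower {n} n≤i refl with qs | ch
    ...   | []     | _ = subst (_≤ℚ K) (sym (ℚP.+-identityʳ _)) (proj₂ (lift-bounds p (outC⇒∈λ Y C p∉C)))
    ...   | q ∷ qs′ | (p≤q , p≢q) , q∈C , ch′ with cell-cover-above n≤i q p≤q (p≢q ∘ sym)
    ...     | inj₁ above≤q = ℚP.≤-trans (ℚP.+-monoˡ-≤ _ (lift-cell-suc≤X-above n≤i p∈λ))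
      (X-chain (above n) (q ∷ qs′) above∉C ((above≤q , outC-≢-C Y C above∉C q∈C) , q∈C , ch′))
      where
      p∈λ = outC⇒∈λ Y C p∉C
      above∉C = above-outC n≤i p∈λ
    ...     | inj₂ left≤q  = ℚP.≤-trans (ℚP.+-monoˡ-≤ _ (lift-cell-suc≤X-left n≤i p∈λ))
      (X-chain (left n) (q ∷ qs′) left∉C ((left≤q , outC-≢-C Y C left∉C q∈C) , q∈C , ch′))
      where
      p∈λ = outC⇒∈λ Y C p∉C
      left∉C = left-outC n≤i p∈λ

    lift∈ : ScaledChainOrder Y C K lift
    lift∈ = lift-bounds , lift-mono , lift-chain

    δ-absent : ∀ {m} → mem (cell (suc m)) ≡ false → δ m ≡ 0ℚ
    δ-absent {m} cell-suc∉λ = trans (cong₂ _-_ (minNeighbour-absent X∈ cell-suc∉λ) mixedMin≡0) (ℚP.+-inverseʳ 0ℚ)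
      where
      mixedMin≡0 : mixedMin m ≡ 0ℚ
      mixedMin≡0 = trans (cong₂ (λ p q → t * p + u * q) (minNeighbour-absent x∈ cell-suc∉λ)
                                                          (minNeighbour-absent x′∈ cell-suc∉λ))
                         (trans (cong₂ _+_ (ℚP.*-zeroʳ t) (ℚP.*-zeroʳ u)) (ℚP.+-identityʳ 0ℚ))

    module _ (P : Cell → Bool)
             (P-agrees : ∀ {m} → m ≤ i → mem (cell (suc m)) ≡ true → P (cell (suc m)) ≡ P (cell m)) where

      private
        F = filterᵇ P (cells Y)
        ms = downFrom (suc i)

        sumOver-w : ∀ {m} → m ≤ i → δ m * sumWith (w m) F ≡ 0ℚ
        sumOver-w {m} m≤i = by-membership (mem (cell (suc m))) refl
          where
          by-membership : ∀ β → mem (cell (suc m)) ≡ β → δ m * sumWith (w m) F ≡ 0ℚ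
          by-membership false cell-suc∉λ = trans (cong (_* sumWith (w m) F) (δ-absent cell-suc∉λ)) (ℚP.*-zeroˡ (sumWith (w m) F))
          by-membership true  cell-suc∈λ = trans (cong (δ m *_) w-sum≡0) (ℚP.*-zeroʳ (δ m))
            where
            w-sum≡0 : sumWith (w m) F ≡ 0ℚ
            w-sum≡0 = begin
              sumWith (w m) F                                                ≡⟨ sumWith-sub (e Y (cell (suc m))) (e Y (cell m)) F ⟩
              sumWith (e Y (cell (suc m))) F - sumWith (e Y (cell m)) F       ≡⟨ cong₂ _-_
                (trans (sym (sumOver≡sumWith-filterᵇ Y P (e Y (cell (suc m))))) (sumOver-e Y P cell-suc∈λ))
                (trans (sym (sumOver≡sumWith-filterᵇ Y P (e Y (cell m)))) (sumOver-e Y P (cell-∈λ m≤i))) ⟩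
              (if P (cell (suc m)) then 1ℚ else 0ℚ) - (if P (cell m) then 1ℚ else 0ℚ)
                ≡⟨ cong (λ b → (if b then 1ℚ else 0ℚ) - (if P (cell m) then 1ℚ else 0ℚ)) (P-agrees m≤i cell-suc∈λ) ⟩
              (if P (cell m) then 1ℚ else 0ℚ) - (if P (cell m) then 1ℚ else 0ℚ)
                ≡⟨ ℚP.+-inverseʳ (if P (cell m) then 1ℚ else 0ℚ) ⟩
              0ℚ                                                             ∎
              where
              open ≡-Reasoning

      sumOver-lift : sumOver Y P lift ≡ t * sumOver Y P x + u * sumOver Y P x′
      sumOver-lift = begin
        sumOver Y P lift                                                      ≡⟨ sumOver≡sumWith-filterᵇ Y P lift ⟩
        sumWith lift F                                                        ≡⟨ sumWith-+ X _ F ⟩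
        sumWith X F + sumWith (λ p → sumWith (λ m → δ m * w m p) ms) F         ≡⟨ cong (sumWith X F +_) moved≡0 ⟩
        sumWith X F + 0ℚ                                                      ≡⟨ ℚP.+-identityʳ _ ⟩
        sumWith X F                                                           ≡⟨ sumWith-+ (λ p → t * x p) (λ p → u * x′ p) F ⟩
        sumWith (λ p → t * x p) F + sumWith (λ p → u * x′ p) F                ≡⟨ cong₂ _+_ (sumWith-*ˡ t x F) (sumWith-*ˡ u x′ F) ⟩
        t * sumWith x F + u * sumWith x′ F                                     ≡⟨ cong₂ (λ s s′ → t * s + u * s′)
                                                                                   (sumOver≡sumWith-filterᵇ Y P x)
                                                                                   (sumOver≡sumWith-filterᵇ Y P x′) ⟨
        t * sumOver Y P x + u * sumOver Y P x′                                 ∎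
        where
        open ≡-Reasoning
        moved≡0 : sumWith (λ p → sumWith (λ m → δ m * w m p) ms) F ≡ 0ℚ
        moved≡0 = trans (sumWith-comm (λ p m → δ m * w m p) F ms)
          (sumWith-zero λ {m} m∈ → trans (sumWith-*ˡ (δ m) (w m) F) (sumOver-w (ℕP.≤-pred (∈-downFrom⁻ m∈))))

    diagonalSum-lift : ∀ ℓ {d} → diagonalSum Y C ℓ x ≡ d → diagonalSum Y C ℓ x′ ≡ d → diagonalSum Y C ℓ lift ≡ d
    diagonalSum-lift ℓ {d} x≡d x′≡d = begin
      diagonalSum Y C ℓ lift
        ≡⟨ cong₂ _+_ (cong₂ _-_ (sumOver-lift (Sbar Y C ℓ) (Sbar-agrees ℓ)) (sumOver-lift (Tbar Y C ℓ) (Tbar-agrees ℓ)))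
                     (sumOver-lift (CR Y C ℓ) (CR-agrees ℓ)) ⟩
      ((t * Σx (Sbar Y C ℓ) + u * Σx′ (Sbar Y C ℓ)) - (t * Σx (Tbar Y C ℓ) + u * Σx′ (Tbar Y C ℓ)))
        + (t * Σx (CR Y C ℓ) + u * Σx′ (CR Y C ℓ))
        ≡⟨ combination-linear t _ _ _ _ _ _ ⟩
      t * diagonalSum Y C ℓ x + u * diagonalSum Y C ℓ x′ ≡⟨ cong₂ (λ s s′ → t * s + u * s′) x≡d x′≡d ⟩
      t * d + u * d                                     ≡⟨ convex-combination-same t d ⟩
      d                                                 ∎
      where
      open ≡-Reasoning
      Σx Σx′ : (Cell → Bool) → ℚ
      Σx P = sumOver Y P x
      Σx′ P = sumOver Y P x′

open CellsOfYoungDiagrams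
open ScaledChainOrders
open DiagonalConstraints
open DiagonalCells
open import Data.Nat using (ℕ; _≤_)
import Data.Nat.Properties as ℕP
open import Data.Integer using (ℤ)
open import Data.Product using (_,_; proj₁; proj₂)
open import Data.Bool using (Bool)
import Data.Rational as ℚ
open import Relation.Binary.PropositionalEquality

lemma4p3 : (Y : YoungDiagram) (d : ℤ → ℕ) (k : ℕ) (C : Cell → Bool) →
           IsUpSet Y C → ProperSub Y C →
           (a b : ℕ) → MaximalOutside Y C (a , b) →
           (i : ℕ) → i ≤ imax Y a b →
           Convex Y (MutatedImage Y C k d a b i)
lemma4p3 Y d k C up _ a b r-max i i≤imax y z t
         (x , (x∈ , x-diagonals) , Φx≡y) (x′ , (x′∈ , x′-diagonals) , Φx′≡z) 0≤t t≤1 =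
  lift ,
  (scaled⇒dilated Y C C⊆λ k lift∈ ,
   λ ℓ ℓ∈range → diagonalSum-lift ℓ (x-diagonals ℓ ℓ∈range) (x′-diagonals ℓ ℓ∈range)) ,
  λ p p∈λ → trans (Φ-lift p) (cong₂ (λ v v′ → t ℚ.* v ℚ.+ (ℚ.1ℚ ℚ.- t) ℚ.* v′) (Φx≡y p p∈λ) (Φx′≡z p p∈λ))
  where
  C⊆λ = proj₁ up
  1≤r = ∈λ⇒1≤ Y (BelowMaximal.r∈λ Y C up r-max)
  i<a⊓b = i≤m∸1⇒i<m (ℕP.⊓-glb (proj₁ 1≤r) (proj₂ 1≤r)) i≤imax
  open DiagonalLift Y C up r-max i (ℕP.≤-trans i<a⊓b (ℕP.m⊓n≤m a b)) (ℕP.≤-trans i<a⊓b (ℕP.m⊓n≤n a b))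
  open ConvexLift (dilated⇒scaled Y C C⊆λ k x∈) (dilated⇒scaled Y C C⊆λ k x′∈) 0≤t t≤1
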